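{- Let $n\ge 2$ and let $\mathfrak{e}_{C_n}$ be the electrical Lie algebra of type $C_n$ with generators $e_1,\dots,e_n$. For $1\le i<j\le n$ set \[u_{i,j}=[e_i[e_{i-1}[\cdots[e_2[e_1[e_1[e_2[\cdots[e_{j-1}e_j]\cdots]\] (the bracket of $e_i,e_{i-1},\dots,e_2,e_1,e_1,e_2,\dots,e_{j-1},e_j$ nested to the right; e.g. $u_{1,j}=[e_1[e_1[e_2[\cdots[e_{j-1}e_j]\cdots]$, $u_{2,3}=[e_2[e_1[e_1[e_2e_3]]]]$). Let $S=\{u_{i,j}:1\le i<j\le n\}\setminus\{u_{1,2}\}$, where $u_{1,2}=[e_1[e_1e_2]]$. Then the linear span $I'$ of $S$ is an ideal of $\mathfrak{e}_{C_n}$.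
   Context: All Lie algebras are over $\mathbb{C}$. The electrical Lie algebra $\mathfrak{e}_{C_n}$ is generated by $e_1,\dots,e_n$ subject to: $[e_i,e_j]=0$ if $|i-j|\ge 2$; $[e_i,[e_i,e_j]]=-2e_i$ if $|i-j|=1$ and $i\ne 1$; and $[e_1,[e_1,[e_1,e_2]]]=0$. -}

module Defs where

open import Level using (Level; _⊔_)
open import Algebra.Bundles using (CommutativeRing)
open import Data.Nat as ℕ using (ℕ; zero; suc; _∸_; _≤_; _<_; _≥_; s≤s; z≤n)
open import Data.Nat.Properties using (_≤?_)
open import Data.Fin as Fin using (Fin; toℕ; fromℕ<)
open import Data.List using (List; []; _∷_; _++_)
open import Data.Product using (Σ; _×_; _,_; ∃)
open import Relation.Nullary using (¬_; yes; no)
open import Relation.Binary.PropositionalEquality using (_≡_)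

record Field (c ℓ : Level) : Set (Level.suc (c ⊔ ℓ)) where
  field
    commutativeRing : CommutativeRing c ℓ
  open CommutativeRing commutativeRing public
  field
    1≉0     : ¬ (1# ≈ 0#)
    inverse : ∀ (a : Carrier) → ¬ (a ≈ 0#) → Σ Carrier (λ b → a * b ≈ 1#)

module _ {c ℓ : Level} (K : Field c ℓ) where
  open Field K

  natCast : ℕ → Carrier
  natCast zero    = 0#
  natCast (suc m) = 1# + natCast m

  CharZero : Set ℓ
  CharZero = ∀ (m : ℕ) → ¬ (natCast (suc m) ≈ 0#)

-- The electrical Lie algebra e_{C_n} over a field K, as the term model
-- of the presentation: formal Lie expressions in generators gen i
-- (gen i stands for e_{toℕ i + 1}), modulo the least congruence
-- containing the K-vector-space axioms, the Lie algebra axioms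
-- (bilinearity, alternation, Jacobi) and the defining relations.

module Electrical {c ℓ : Level} (K : Field c ℓ) (n : ℕ) where
  open Field K renaming (Carrier to Sc; _≈_ to _≈K_; _+_ to _+K_; _*_ to _*K_; -_ to -K_)

  infixl 6 _⊕_
  infixr 7 _⊙_

  data Elt : Set c where
    gen  : Fin n → Elt
    𝟘    : Elt
    _⊕_  : Elt → Elt → Elt
    _⊙_  : Sc → Elt → Elt
    ⁅_,_⁆ : Elt → Elt → Elt

  idx : Fin n → ℕ
  idx i = suc (toℕ i)

  dist : ℕ → ℕ → ℕ
  dist a b = (a ∸ b) ℕ.+ (b ∸ a)

  two : Sc
  two = 1# +K 1#

  infix 4 _≈_

  data _≈_ : Elt → Elt → Set (c ⊔ ℓ) where
    ≈-refl  : ∀ {x} → x ≈ x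
    ≈-sym   : ∀ {x y} → x ≈ y → y ≈ x
    ≈-trans : ∀ {x y z} → x ≈ y → y ≈ z → x ≈ z
    ⊕-cong  : ∀ {x x′ y y′} → x ≈ x′ → y ≈ y′ → x ⊕ y ≈ x′ ⊕ y′
    ⊙-cong  : ∀ {a a′ x x′} → a ≈K a′ → x ≈ x′ → a ⊙ x ≈ a′ ⊙ x′
    br-cong : ∀ {x x′ y y′} → x ≈ x′ → y ≈ y′ → ⁅ x , y ⁆ ≈ ⁅ x′ , y′ ⁆
    ⊕-assoc : ∀ x y z → (x ⊕ y) ⊕ z ≈ x ⊕ (y ⊕ z)
    ⊕-comm  : ∀ x y → x ⊕ y ≈ y ⊕ x
    ⊕-idʳ   : ∀ x → x ⊕ 𝟘 ≈ x
    ⊕-invʳ  : ∀ x → x ⊕ ((-K 1#) ⊙ x) ≈ 𝟘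
    ⊙-assoc : ∀ a b x → a ⊙ (b ⊙ x) ≈ (a *K b) ⊙ x
    ⊙-id    : ∀ x → 1# ⊙ x ≈ x
    ⊙-distˡ : ∀ a x y → a ⊙ (x ⊕ y) ≈ (a ⊙ x) ⊕ (a ⊙ y)
    ⊙-distʳ : ∀ a b x → (a +K b) ⊙ x ≈ (a ⊙ x) ⊕ (b ⊙ x)
    br-⊕ˡ   : ∀ x y z → ⁅ x ⊕ y , z ⁆ ≈ ⁅ x , z ⁆ ⊕ ⁅ y , z ⁆
    br-⊙ˡ   : ∀ a x y → ⁅ a ⊙ x , y ⁆ ≈ a ⊙ ⁅ x , y ⁆
    br-⊕ʳ   : ∀ x y z → ⁅ x , y ⊕ z ⁆ ≈ ⁅ x , y ⁆ ⊕ ⁅ x , z ⁆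
    br-⊙ʳ   : ∀ a x y → ⁅ x , a ⊙ y ⁆ ≈ a ⊙ ⁅ x , y ⁆
    br-alt  : ∀ x → ⁅ x , x ⁆ ≈ 𝟘
    jacobi  : ∀ x y z →
              ⁅ x , ⁅ y , z ⁆ ⁆ ⊕ ⁅ y , ⁅ z , x ⁆ ⁆ ⊕ ⁅ z , ⁅ x , y ⁆ ⁆ ≈ 𝟘
    rel-far : ∀ i j → 2 ≤ dist (idx i) (idx j) → ⁅ gen i , gen j ⁆ ≈ 𝟘
    rel-adj : ∀ i j → dist (idx i) (idx j) ≡ 1 → ¬ (idx i ≡ 1) →
              ⁅ gen i , ⁅ gen i , gen j ⁆ ⁆ ≈ (-K two) ⊙ gen i
    rel-one : ∀ i j → idx i ≡ 1 → idx j ≡ 2 →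
              ⁅ gen i , ⁅ gen i , ⁅ gen i , gen j ⁆ ⁆ ⁆ ≈ 𝟘

  -- e k for a 1-based index k; only ever used with 1 ≤ k ≤ n
  -- (out-of-range indices are sent to 0, a junk value never used).
  e : ℕ → Elt
  e zero    = 𝟘
  e (suc k) with suc k ≤? n
  ... | yes p = gen (fromℕ< p)
  ... | no _  = 𝟘

  nest : Elt → List Elt → Elt
  nest x []       = x
  nest x (y ∷ ys) = ⁅ x , nest y ys ⁆

  down : ℕ → List ℕ
  down zero    = []
  down (suc k) = suc k ∷ down k

  upFrom : ℕ → ℕ → List ℕ
  upFrom a zero    = []
  upFrom a (suc m) = a ∷ upFrom (suc a) m

  mapE : List ℕ → List Elt
  mapE []       = []
  mapE (k ∷ ks) = e k ∷ mapE ks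

  u : ℕ → ℕ → Elt
  u i j with mapE (down i ++ upFrom 1 j)
  ... | []     = 𝟘
  ... | x ∷ xs = nest x xs

  SIndex : Set
  SIndex = Σ (ℕ × ℕ) (λ { (i , j) → (1 ≤ i) × (i < j) × (j ≤ n) × ¬ ((i , j) ≡ (1 , 2)) })

  uS : SIndex → Elt
  uS ((i , j) , _) = u i j

  lincomb : List (Sc × SIndex) → Elt
  lincomb []             = 𝟘
  lincomb ((a , s) ∷ cs) = (a ⊙ uS s) ⊕ lincomb cs

  InSpanS : Elt → Set (c ⊔ ℓ)
  InSpanS y = Σ (List (Sc × SIndex)) (λ cs → y ≈ lincomb cs)

  record IsIdeal {p} (P : Elt → Set p) : Set (c ⊔ ℓ ⊔ p) where
    field
      resp  : ∀ {x y} → x ≈ y → P x → P y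
      zero∈ : P 𝟘
      ⊕∈    : ∀ {x y} → P x → P y → P (x ⊕ y)
      ⊙∈    : ∀ a {x} → P x → P (a ⊙ x)
      br∈   : ∀ x {y} → P y → P ⁅ x , y ⁆

-- Write ad_k = [e_k, –] and y_j = [e_1[e_2[⋯[e_{j−1} e_j]⋯], so that u_{i,j} = ad_i ⋯ ad_1 y_j.
-- The span I′ of S is a subspace, and by the Jacobi identity the x with [x, I′] ⊆ I′ form a Lie
-- subalgebra, so it suffices to show ad_k u_{i,j} ∈ I′ for every generator e_k. Generators at
-- distance at least 2 commute, so ad_k moves past every factor ad_m with |m − k| ≥ 2, and a case
-- analysis on the position of k relative to i and j shows that ad_k u_{i,j} is 0 or ±u_{i′,j′}
-- with u_{i′,j′} ∈ S. The remaining local computations use the defining relations in operator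
-- form, ad_a² ad_b − 2 ad_a ad_b ad_a + ad_b ad_a² = −2 ad_a for adjacent a, b with a ≥ 2, and
-- ad_1³ ad_2 − 3 ad_1² ad_2 ad_1 + 3 ad_1 ad_2 ad_1² − ad_2 ad_1³ = 0; solving them for a single
-- term divides by 2 or 3, which is where characteristic zero is needed.

module Submission where

open import Defs
open import Level using (Level; _⊔_)
open import Algebra.Bundles using (AbelianGroup; CommutativeRing)
import Algebra.Properties.Ring as RingProperties
open import Relation.Binary.Bundles using (Setoid)
open import Data.Nat using (ℕ; zero; suc; _+_; _*_; _∸_; _≤_; _<_; z≤n; s≤s; NonZero)
open import Data.Nat.Properties
  using ( _≟_; _<?_; _≤?_; suc-injective; ≤-refl; ≤-trans; ≤-antisym; ≤-pred; <⇒≢; n≤1+n; m≤n+m; m≤m+n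
        ; m≤n⇒m<n∨m≡n; m≤n⇒∃[o]m+o≡n; +-comm; +-suc; 0∸n≡0 )
open import Data.Product as Product using (_,_; map₁)
open import Data.Sum using (_⊎_; inj₁; inj₂)
open import Relation.Nullary using (¬_; yes; no; contradiction)
open import Data.Fin using (Fin; zero; suc; #_; toℕ; fromℕ<)
open import Data.Fin.Properties using (toℕ-fromℕ<; toℕ<n; toℕ-injective)
open import Data.List using (List; []; _∷_; _++_; map)
open import Data.Vec using (Vec; []; _∷_; lookup)
open import Data.Vec.Relation.Unary.All using (All; []; _∷_; all?)
open import Relation.Nullary.Decidable using (True; toWitness)
open import Relation.Binary.PropositionalEquality as ≡ using (_≡_)

module LinearCertificates {g ℓ} (G : AbelianGroup g ℓ) where
  open AbelianGroup G
  open import Algebra.Properties.AbelianGroup G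
  open import Algebra.Properties.CommutativeMonoid.Mult commutativeMonoid
  open import Algebra.Properties.CommutativeSemigroup commutativeSemigroup using (interchange)
  open import Relation.Binary.Reasoning.Setoid setoid

  infixl 6 _⊞_
  infixr 7 _⊠_
  infix  8 ⊟_

  data Expr (m : ℕ) : Set where
    var : Fin m → Expr m
    ∅   : Expr m
    _⊞_ : Expr m → Expr m → Expr m
    ⊟_  : Expr m → Expr m
    _⊠_ : ℕ → Expr m → Expr m

  v : ∀ {m} i {i<m : True (i <? m)} → Expr m
  v i {i<m} = var (#_ i {m<n = i<m})

  ⟦_⟧ : ∀ {m} → Expr m → Vec Carrier m → Carrier
  ⟦ var i ⟧ ρ = lookup ρ i
  ⟦ ∅ ⟧     ρ = ε
  ⟦ a ⊞ b ⟧ ρ = ⟦ a ⟧ ρ ∙ ⟦ b ⟧ ρ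
  ⟦ ⊟ a ⟧   ρ = ⟦ a ⟧ ρ ⁻¹
  ⟦ k ⊠ a ⟧ ρ = k × ⟦ a ⟧ ρ

  -- The coefficient of each variable is kept as a formal difference p − q of naturals.
  Normal : ℕ → Set
  Normal m = Vec (ℕ Product.× ℕ) m

  zeroₙ : ∀ {m} → Normal m
  zeroₙ {zero}  = []
  zeroₙ {suc m} = (0 , 0) ∷ zeroₙ

  unitₙ : ∀ {m} → Fin m → Normal m
  unitₙ zero    = (1 , 0) ∷ zeroₙ
  unitₙ (suc i) = (0 , 0) ∷ unitₙ i

  _+ₙ_ : ∀ {m} → Normal m → Normal m → Normal m
  []             +ₙ []               = []
  ((p , q) ∷ a) +ₙ ((p′ , q′) ∷ b) = (p + p′ , q + q′) ∷ (a +ₙ b)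

  -ₙ_ : ∀ {m} → Normal m → Normal m
  -ₙ []            = []
  -ₙ ((p , q) ∷ a) = (q , p) ∷ (-ₙ a)

  _·ₙ_ : ∀ {m} → ℕ → Normal m → Normal m
  k ·ₙ []            = []
  k ·ₙ ((p , q) ∷ a) = (k * p , k * q) ∷ (k ·ₙ a)

  normalise : ∀ {m} → Expr m → Normal m
  normalise (var i) = unitₙ i
  normalise ∅       = zeroₙ
  normalise (a ⊞ b) = normalise a +ₙ normalise b
  normalise (⊟ a)   = -ₙ normalise a
  normalise (k ⊠ a) = k ·ₙ normalise a

  ⟦_⟧ₙ : ∀ {m} → Normal m → Vec Carrier m → Carrier
  ⟦ [] ⟧ₙ            []      = ε
  ⟦ (p , q) ∷ a ⟧ₙ (x ∷ ρ) = (p × x - q × x) ∙ ⟦ a ⟧ₙ ρ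

  ×-identityʳ : ∀ k → k × ε ≈ ε
  ×-identityʳ zero    = refl
  ×-identityʳ (suc k) = trans (identityˡ _) (×-identityʳ k)

  ×-⁻¹ : ∀ k x → k × (x ⁻¹) ≈ (k × x) ⁻¹
  ×-⁻¹ zero    x = sym ε⁻¹≈ε
  ×-⁻¹ (suc k) x = trans (∙-congˡ (×-⁻¹ k x)) (⁻¹-∙-comm x (k × x))

  -‿interchange : ∀ a b c d → (a ∙ b) - (c ∙ d) ≈ (a - c) ∙ (b - d)
  -‿interchange a b c d = begin
    (a ∙ b) ∙ (c ∙ d) ⁻¹       ≈⟨ ∙-congˡ (⁻¹-∙-comm c d) ⟨
    (a ∙ b) ∙ (c ⁻¹ ∙ d ⁻¹)    ≈⟨ interchange a b (c ⁻¹) (d ⁻¹) ⟩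
    (a - c) ∙ (b - d)          ∎

  ε-ε≈ε : ε - ε ≈ ε
  ε-ε≈ε = trans (identityˡ _) ε⁻¹≈ε

  ⟦zero⟧ₙ : ∀ {m} (ρ : Vec Carrier m) → ⟦ zeroₙ ⟧ₙ ρ ≈ ε
  ⟦zero⟧ₙ []      = refl
  ⟦zero⟧ₙ (x ∷ ρ) = trans (∙-cong ε-ε≈ε (⟦zero⟧ₙ ρ)) (identityˡ ε)

  ⟦unit⟧ₙ : ∀ {m} (i : Fin m) (ρ : Vec Carrier m) → ⟦ unitₙ i ⟧ₙ ρ ≈ lookup ρ i
  ⟦unit⟧ₙ zero    (x ∷ ρ) = begin
    (x ∙ ε - ε) ∙ ⟦ zeroₙ ⟧ₙ ρ  ≈⟨ ∙-cong (∙-cong (identityʳ x) ε⁻¹≈ε) (⟦zero⟧ₙ ρ) ⟩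
    (x ∙ ε) ∙ ε                 ≈⟨ trans (identityʳ _) (identityʳ x) ⟩
    x                           ∎
  ⟦unit⟧ₙ (suc i) (x ∷ ρ) = trans (∙-cong ε-ε≈ε (⟦unit⟧ₙ i ρ)) (identityˡ _)

  ⟦+⟧ₙ : ∀ {m} (a b : Normal m) ρ → ⟦ a +ₙ b ⟧ₙ ρ ≈ ⟦ a ⟧ₙ ρ ∙ ⟦ b ⟧ₙ ρ
  ⟦+⟧ₙ [] [] [] = sym (identityˡ ε)
  ⟦+⟧ₙ ((p , q) ∷ a) ((p′ , q′) ∷ b) (x ∷ ρ) = begin
    ((p + p′) × x - (q + q′) × x) ∙ ⟦ a +ₙ b ⟧ₙ ρ
      ≈⟨ ∙-cong (//-cong₂ (×-homo-+ x p p′) (×-homo-+ x q q′)) (⟦+⟧ₙ a b ρ) ⟩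
    ((p × x ∙ p′ × x) - (q × x ∙ q′ × x)) ∙ (⟦ a ⟧ₙ ρ ∙ ⟦ b ⟧ₙ ρ)
      ≈⟨ ∙-congʳ (-‿interchange _ _ _ _) ⟩
    ((p × x - q × x) ∙ (p′ × x - q′ × x)) ∙ (⟦ a ⟧ₙ ρ ∙ ⟦ b ⟧ₙ ρ)
      ≈⟨ interchange _ _ _ _ ⟩
    ((p × x - q × x) ∙ ⟦ a ⟧ₙ ρ) ∙ ((p′ × x - q′ × x) ∙ ⟦ b ⟧ₙ ρ)
      ∎

  ⟦-⟧ₙ : ∀ {m} (a : Normal m) ρ → ⟦ -ₙ a ⟧ₙ ρ ≈ ⟦ a ⟧ₙ ρ ⁻¹
  ⟦-⟧ₙ [] [] = sym ε⁻¹≈ε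
  ⟦-⟧ₙ ((p , q) ∷ a) (x ∷ ρ) = begin
    (q × x - p × x) ∙ ⟦ -ₙ a ⟧ₙ ρ
      ≈⟨ ∙-cong (⁻¹-anti-homo-// (p × x) (q × x)) (sym (⟦-⟧ₙ a ρ)) ⟨
    (p × x - q × x) ⁻¹ ∙ ⟦ a ⟧ₙ ρ ⁻¹      ≈⟨ ⁻¹-∙-comm _ _ ⟩
    ((p × x - q × x) ∙ ⟦ a ⟧ₙ ρ) ⁻¹       ∎

  ⟦·⟧ₙ : ∀ {m} k (a : Normal m) ρ → ⟦ k ·ₙ a ⟧ₙ ρ ≈ k × ⟦ a ⟧ₙ ρ
  ⟦·⟧ₙ k [] [] = sym (×-identityʳ k)
  ⟦·⟧ₙ k ((p , q) ∷ a) (x ∷ ρ) = begin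
    ((k * p) × x - (k * q) × x) ∙ ⟦ k ·ₙ a ⟧ₙ ρ
      ≈⟨ ∙-cong (//-cong₂ (×-assocˡ x k p) (×-assocˡ x k q)) (sym (⟦·⟧ₙ k a ρ)) ⟨
    (k × (p × x) - k × (q × x)) ∙ k × ⟦ a ⟧ₙ ρ
      ≈⟨ ∙-congʳ (∙-congˡ (×-⁻¹ k (q × x))) ⟨
    (k × (p × x) ∙ k × ((q × x) ⁻¹)) ∙ k × ⟦ a ⟧ₙ ρ
      ≈⟨ ∙-congʳ (×-distrib-+ _ _ k) ⟨
    k × (p × x - q × x) ∙ k × ⟦ a ⟧ₙ ρ
      ≈⟨ ×-distrib-+ _ _ k ⟨
    k × ((p × x - q × x) ∙ ⟦ a ⟧ₙ ρ)
      ∎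

  normalise-sound : ∀ {m} (a : Expr m) ρ → ⟦ a ⟧ ρ ≈ ⟦ normalise a ⟧ₙ ρ
  normalise-sound (var i) ρ = sym (⟦unit⟧ₙ i ρ)
  normalise-sound ∅       ρ = sym (⟦zero⟧ₙ ρ)
  normalise-sound (a ⊞ b) ρ =
    trans (∙-cong (normalise-sound a ρ) (normalise-sound b ρ)) (sym (⟦+⟧ₙ (normalise a) (normalise b) ρ))
  normalise-sound (⊟ a)   ρ = trans (⁻¹-cong (normalise-sound a ρ)) (sym (⟦-⟧ₙ (normalise a) ρ))
  normalise-sound (k ⊠ a) ρ = trans (×-congʳ k (normalise-sound a ρ)) (sym (⟦·⟧ₙ k (normalise a) ρ))

  Balanced : ∀ {m} → Normal m → Set
  Balanced = All (λ { (p , q) → p ≡ q })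

  balanced? : ∀ {m} (a : Normal m) → _
  balanced? = all? (λ { (p , q) → p ≟ q })

  ⟦balanced⟧ₙ : ∀ {m} {a : Normal m} ρ → Balanced a → ⟦ a ⟧ₙ ρ ≈ ε
  ⟦balanced⟧ₙ [] [] = refl
  ⟦balanced⟧ₙ {a = (p , p) ∷ _} (x ∷ ρ) (≡.refl ∷ bal) =
    trans (∙-cong (inverseʳ (p × x)) (⟦balanced⟧ₙ ρ bal)) (identityˡ ε)

  record Hypothesis {m} (ρ : Vec Carrier m) : Set (g ⊔ ℓ) where
    constructor hyp
    field
      weight   : ℕ
      lhs rhs  : Expr m
      lhs≈rhs  : ⟦ lhs ⟧ ρ ≈ ⟦ rhs ⟧ ρ

  combination : ∀ {m} {ρ : Vec Carrier m} → List (Hypothesis ρ) → Expr m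
  combination []                  = ∅
  combination (hyp w l r _ ∷ hs) = w ⊠ (l ⊞ ⊟ r) ⊞ combination hs

  ⟦combination⟧ : ∀ {m} {ρ : Vec Carrier m} (hs : List (Hypothesis ρ)) → ⟦ combination hs ⟧ ρ ≈ ε
  ⟦combination⟧ []                    = refl
  ⟦combination⟧ (hyp w l r l≈r ∷ hs) = begin
    w × (⟦ l ⟧ _ - ⟦ r ⟧ _) ∙ ⟦ combination hs ⟧ _
      ≈⟨ ∙-cong (×-congʳ w (x≈y⇒x∙y⁻¹≈ε l≈r)) (⟦combination⟧ hs) ⟩
    w × ε ∙ ε
      ≈⟨ trans (identityʳ _) (×-identityʳ w) ⟩
    ε ∎

  -- If w (L − R) minus a weighted sum of differences lhs − rhs of valid equations
  -- normalises to zero, then w (L − R) = 0.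
  solve-× : ∀ {m} (ρ : Vec Carrier m) w (L R : Expr m) (hs : List (Hypothesis ρ)) →
            {_ : True (balanced? (normalise (w ⊠ (L ⊞ ⊟ R) ⊞ ⊟ combination hs)))} →
            w × (⟦ L ⟧ ρ - ⟦ R ⟧ ρ) ≈ ε
  solve-× ρ w L R hs {bal} = begin
    w × (⟦ L ⟧ ρ - ⟦ R ⟧ ρ)                  ≈⟨ identityʳ _ ⟨
    w × (⟦ L ⟧ ρ - ⟦ R ⟧ ρ) ∙ ε              ≈⟨ ∙-congˡ (trans (⁻¹-cong (⟦combination⟧ hs)) ε⁻¹≈ε) ⟨
    ⟦ difference ⟧ ρ                         ≈⟨ normalise-sound difference ρ ⟩
    ⟦ normalise difference ⟧ₙ ρ              ≈⟨ ⟦balanced⟧ₙ ρ (toWitness bal) ⟩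
    ε                                        ∎
    where
    difference : Expr _
    difference = w ⊠ (L ⊞ ⊟ R) ⊞ ⊟ combination hs

  solve : ∀ {m} (ρ : Vec Carrier m) (L R : Expr m) (hs : List (Hypothesis ρ)) →
          {_ : True (balanced? (normalise (1 ⊠ (L ⊞ ⊟ R) ⊞ ⊟ combination hs)))} →
          ⟦ L ⟧ ρ ≈ ⟦ R ⟧ ρ
  solve ρ L R hs {bal} = x∙y⁻¹≈ε⇒x≈y _ _ (trans (sym (×-homo-1 _)) (solve-× ρ 1 L R hs {bal}))

data Position (m n : ℕ) : Set where
  far-below  : 2 + m ≤ n → Position m n
  just-below : suc m ≡ n → Position m n
  equal      : m ≡ n     → Position m n
  just-above : m ≡ suc n → Position m n
  far-above  : 2 + n ≤ m → Position m n

position : ∀ m n → Position m n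
position zero          zero          = equal ≡.refl
position zero          (suc zero)    = just-below ≡.refl
position zero          (suc (suc n)) = far-below (s≤s (s≤s z≤n))
position (suc zero)    zero          = just-above ≡.refl
position (suc (suc m)) zero          = far-above (s≤s (s≤s z≤n))
position (suc m)       (suc n) with position m n
... | far-below  m+2≤n = far-below (s≤s m+2≤n)
... | just-below m+1≡n = just-below (≡.cong suc m+1≡n)
... | equal      m≡n   = equal (≡.cong suc m≡n)
... | just-above m≡n+1 = just-above (≡.cong suc m≡n+1)
... | far-above  n+2≤m = far-above (s≤s n+2≤m)

module ElectricalAlgebra {c ℓ} (K : Field c ℓ) (n : ℕ) where
  open Field K using (commutativeRing; inverse)
    renaming (Carrier to Sc; _≈_ to _≈ᴷ_; _+_ to _+ᴷ_; _*_ to _*ᴷ_; -_ to -ᴷ_; 0# to 0ᴷ; 1# to 1ᴷ)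
  private
    module KR = CommutativeRing commutativeRing
    module KP = RingProperties KR.ring
  open Electrical K n

  infix 8 -_
  -_ : Elt → Elt
  - x = (-ᴷ 1ᴷ) ⊙ x

  ≈-setoid : Setoid c (c ⊔ ℓ)
  ≈-setoid = record
    { Carrier = Elt ; _≈_ = _≈_
    ; isEquivalence = record { refl = ≈-refl ; sym = ≈-sym ; trans = ≈-trans } }

  ⊕-abelianGroup : AbelianGroup c (c ⊔ ℓ)
  ⊕-abelianGroup = record
    { Carrier = Elt ; _≈_ = _≈_ ; _∙_ = _⊕_ ; ε = 𝟘 ; _⁻¹ = -_
    ; isAbelianGroup = record
      { isGroup = record
        { isMonoid = record
          { isSemigroup = record
            { isMagma = record { isEquivalence = Setoid.isEquivalence ≈-setoid ; ∙-cong = ⊕-cong }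
            ; assoc = ⊕-assoc }
          ; identity = ⊕-identityˡ , ⊕-idʳ }
        ; inverse = (λ x → ≈-trans (⊕-comm (- x) x) (⊕-invʳ x)) , ⊕-invʳ
        ; ⁻¹-cong = ⊙-cong KR.refl }
      ; comm = ⊕-comm } }
    where
    ⊕-identityˡ : ∀ x → 𝟘 ⊕ x ≈ x
    ⊕-identityˡ x = ≈-trans (⊕-comm 𝟘 x) (⊕-idʳ x)

  open LinearCertificates ⊕-abelianGroup
  open AbelianGroup ⊕-abelianGroup using (identityˡ; ⁻¹-cong)
  open import Algebra.Properties.AbelianGroup ⊕-abelianGroup
    using (ε⁻¹≈ε; ⁻¹-involutive; identityˡ-unique; x∙y⁻¹≈ε⇒x≈y)
  open import Algebra.Properties.CommutativeMonoid.Mult (AbelianGroup.commutativeMonoid ⊕-abelianGroup)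
    using (_×_; ×-congʳ)
  open import Relation.Binary.Reasoning.Setoid ≈-setoid
  open Setoid ≈-setoid using () renaming (reflexive to ≡⇒≈)

  ⊙-zeroˡ : ∀ x → 0ᴷ ⊙ x ≈ 𝟘
  ⊙-zeroˡ x = identityˡ-unique _ _ (begin
    0ᴷ ⊙ x ⊕ 0ᴷ ⊙ x  ≈⟨ ⊙-distʳ 0ᴷ 0ᴷ x ⟨
    (0ᴷ +ᴷ 0ᴷ) ⊙ x   ≈⟨ ⊙-cong (KR.+-identityʳ 0ᴷ) ≈-refl ⟩
    0ᴷ ⊙ x           ∎)

  ⊙-zeroʳ : ∀ a → a ⊙ 𝟘 ≈ 𝟘
  ⊙-zeroʳ a = identityˡ-unique _ _ (begin
    a ⊙ 𝟘 ⊕ a ⊙ 𝟘  ≈⟨ ⊙-distˡ a 𝟘 𝟘 ⟨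
    a ⊙ (𝟘 ⊕ 𝟘)    ≈⟨ ⊙-cong KR.refl (⊕-idʳ 𝟘) ⟩
    a ⊙ 𝟘          ∎)

  ×≈natCast⊙ : ∀ k x → k × x ≈ natCast K k ⊙ x
  ×≈natCast⊙ zero    x = ≈-sym (⊙-zeroˡ x)
  ×≈natCast⊙ (suc k) x = begin
    x ⊕ k × x                   ≈⟨ ⊕-cong (≈-sym (⊙-id x)) (×≈natCast⊙ k x) ⟩
    1ᴷ ⊙ x ⊕ natCast K k ⊙ x    ≈⟨ ⊙-distʳ 1ᴷ _ x ⟨
    natCast K (suc k) ⊙ x       ∎

  -two⊙≈ : ∀ x → (-ᴷ two) ⊙ x ≈ - (2 × x)
  -two⊙≈ x = begin
    (-ᴷ two) ⊙ x               ≈⟨ ⊙-cong (KP.-1*x≈-x two) ≈-refl ⟨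
    ((-ᴷ 1ᴷ) *ᴷ two) ⊙ x       ≈⟨ ⊙-assoc _ _ x ⟨
    - (two ⊙ x)                ≈⟨ ⁻¹-cong (⊙-distʳ 1ᴷ 1ᴷ x) ⟩
    - (1ᴷ ⊙ x ⊕ 1ᴷ ⊙ x)        ≈⟨ ⁻¹-cong (⊕-cong (⊙-id x) (≈-trans (⊙-id x) (≈-sym (⊕-idʳ x)))) ⟩
    - (2 × x)                  ∎

  ×-cancel : CharZero K → ∀ w .{{_ : NonZero w}} {x} → w × x ≈ 𝟘 → x ≈ 𝟘
  ×-cancel charZero (suc k) {x} wx≈𝟘 with inverse (natCast K (suc k)) (charZero k)
  ... | b , wb≈1 = begin
    x                              ≈⟨ ⊙-id x ⟨
    1ᴷ ⊙ x                         ≈⟨ ⊙-cong (KR.trans (KR.sym wb≈1) (KR.*-comm _ b)) ≈-refl ⟩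
    (b *ᴷ natCast K (suc k)) ⊙ x   ≈⟨ ⊙-assoc b _ x ⟨
    b ⊙ (natCast K (suc k) ⊙ x)    ≈⟨ ⊙-cong KR.refl (≈-trans (≈-sym (×≈natCast⊙ (suc k) x)) wx≈𝟘) ⟩
    b ⊙ 𝟘                          ≈⟨ ⊙-zeroʳ b ⟩
    𝟘                              ∎

  br-zeroˡ : ∀ y → ⁅ 𝟘 , y ⁆ ≈ 𝟘
  br-zeroˡ y = identityˡ-unique _ _ (≈-trans (≈-sym (br-⊕ˡ 𝟘 𝟘 y)) (br-cong (⊕-idʳ 𝟘) ≈-refl))

  br-zeroʳ : ∀ x → ⁅ x , 𝟘 ⁆ ≈ 𝟘
  br-zeroʳ x = identityˡ-unique _ _ (≈-trans (≈-sym (br-⊕ʳ x 𝟘 𝟘)) (br-cong ≈-refl (⊕-idʳ 𝟘)))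

  br-negˡ : ∀ x y → ⁅ - x , y ⁆ ≈ - ⁅ x , y ⁆
  br-negˡ = br-⊙ˡ (-ᴷ 1ᴷ)

  br-negʳ : ∀ x y → ⁅ x , - y ⁆ ≈ - ⁅ x , y ⁆
  br-negʳ x y = br-⊙ʳ (-ᴷ 1ᴷ) x y

  br-×ˡ : ∀ k x y → ⁅ k × x , y ⁆ ≈ k × ⁅ x , y ⁆
  br-×ˡ zero    x y = br-zeroˡ y
  br-×ˡ (suc k) x y = ≈-trans (br-⊕ˡ x _ y) (⊕-cong ≈-refl (br-×ˡ k x y))

  br-×ʳ : ∀ k x y → ⁅ x , k × y ⁆ ≈ k × ⁅ x , y ⁆
  br-×ʳ zero    x y = br-zeroʳ x
  br-×ʳ (suc k) x y = ≈-trans (br-⊕ʳ x y _) (⊕-cong ≈-refl (br-×ʳ k x y))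

  br-antisym : ∀ x y → ⁅ x , y ⁆ ≈ - ⁅ y , x ⁆
  br-antisym x y = solve
    ( ⁅ x ⊕ y , x ⊕ y ⁆ ∷ ⁅ x , x ⊕ y ⁆ ∷ ⁅ y , x ⊕ y ⁆
    ∷ ⁅ x , x ⁆ ∷ ⁅ x , y ⁆ ∷ ⁅ y , x ⁆ ∷ ⁅ y , y ⁆ ∷ [])
    (v 4) (⊟ v 5)
    ( hyp 1 (v 0) ∅ (br-alt (x ⊕ y))
    ∷ hyp 1 (v 1 ⊞ v 2) (v 0) (≈-sym (br-⊕ˡ x y _))
    ∷ hyp 1 (v 3 ⊞ v 4) (v 1) (≈-sym (br-⊕ʳ x x y))
    ∷ hyp 1 (v 5 ⊞ v 6) (v 2) (≈-sym (br-⊕ʳ y x y))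
    ∷ hyp 1 ∅ (v 3) (≈-sym (br-alt x))
    ∷ hyp 1 ∅ (v 6) (≈-sym (br-alt y))
    ∷ [])

  br-leibniz : ∀ x y z → ⁅ x , ⁅ y , z ⁆ ⁆ ≈ ⁅ ⁅ x , y ⁆ , z ⁆ ⊕ ⁅ y , ⁅ x , z ⁆ ⁆
  br-leibniz x y z = solve
    ( ⁅ x , ⁅ y , z ⁆ ⁆ ∷ ⁅ ⁅ x , y ⁆ , z ⁆ ∷ ⁅ y , ⁅ x , z ⁆ ⁆
    ∷ ⁅ y , ⁅ z , x ⁆ ⁆ ∷ ⁅ z , ⁅ x , y ⁆ ⁆ ∷ [])
    (v 0) (v 1 ⊞ v 2)
    ( hyp 1 (v 0 ⊞ v 3 ⊞ v 4) ∅ (jacobi x y z)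
    ∷ hyp 1 (⊟ v 2) (v 3) (≈-sym (≈-trans (br-cong ≈-refl (br-antisym z x)) (br-negʳ y _)))
    ∷ hyp 1 (⊟ v 1) (v 4) (≈-sym (br-antisym z _))
    ∷ [])

  data Generator (k : ℕ) : Elt → Set c where
    generator : (i : Fin n) → idx i ≡ k → Generator k (gen i)

  e-view : ∀ k → e k ≡ 𝟘 ⊎ Generator k (e k)
  e-view zero = inj₁ ≡.refl
  e-view (suc k) with suc k ≤? n
  ... | yes k<n = inj₂ (generator (fromℕ< k<n) (≡.cong suc (toℕ-fromℕ< k<n)))
  ... | no  _   = inj₁ ≡.refl

  e-inRange : ∀ {k} → 1 ≤ k → k ≤ n → Generator k (e k)
  e-inRange {suc k} _ k<n with suc k ≤? n
  ... | yes k<n′ = generator (fromℕ< k<n′) (≡.cong suc (toℕ-fromℕ< k<n′))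
  ... | no  k≮n  = contradiction k<n k≮n

  e-idx : ∀ i → e (idx i) ≡ gen i
  e-idx i with e (idx i) | e-inRange {idx i} (s≤s z≤n) (toℕ<n i)
  ... | .(gen j) | generator j idx-j≡idx-i =
    ≡.cong gen (toℕ-injective (suc-injective idx-j≡idx-i))

  dist-far : ∀ a b → 2 + a ≤ b → 2 ≤ dist a b
  dist-far zero    b       2≤b       = ≡.subst (2 ≤_) (≡.cong (_+ b) (≡.sym (0∸n≡0 b))) 2≤b
  dist-far (suc a) (suc b) (s≤s a+2≤b) = dist-far a b a+2≤b

  dist-suc : ∀ a → dist a (suc a) ≡ 1
  dist-suc zero    = ≡.refl
  dist-suc (suc a) = dist-suc a

  dist-sym : ∀ a b → dist a b ≡ dist b a
  dist-sym a b = +-comm (a ∸ b) (b ∸ a)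

  e-far : ∀ a b → 2 + a ≤ b → ⁅ e a , e b ⁆ ≈ 𝟘
  e-far a b a+2≤b with e a | e-view a | e b | e-view b
  ... | _ | inj₁ ≡.refl | _ | _ = br-zeroˡ _
  ... | _ | inj₂ _ | _ | inj₁ ≡.refl = br-zeroʳ _
  ... | .(gen i) | inj₂ (generator i ≡.refl) | .(gen j) | inj₂ (generator j ≡.refl) =
    rel-far i j (dist-far (idx i) (idx j) a+2≤b)

  e-far′ : ∀ a b → 2 + b ≤ a → ⁅ e a , e b ⁆ ≈ 𝟘
  e-far′ a b b+2≤a = ≈-trans (br-antisym _ _) (≈-trans (⁻¹-cong (e-far b a b+2≤a)) ε⁻¹≈ε)

  e-adjacent : ∀ {a b} → 2 ≤ a → dist a b ≡ 1 → a ≤ n → 1 ≤ b → b ≤ n →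
               ⁅ e a , ⁅ e a , e b ⁆ ⁆ ≈ - (2 × e a)
  e-adjacent {a} {b} 2≤a ∣a-b∣≡1 a≤n 1≤b b≤n
    with e a | e-inRange (≤-trans (s≤s z≤n) 2≤a) a≤n | e b | e-inRange 1≤b b≤n
  ... | .(gen i) | generator i ≡.refl | .(gen j) | generator j ≡.refl =
    ≈-trans (rel-adj i j ∣a-b∣≡1 (λ idx≡1 → <⇒≢ 2≤a (≡.sym idx≡1))) (-two⊙≈ (gen i))

  e-one : 2 ≤ n → ⁅ e 1 , ⁅ e 1 , ⁅ e 1 , e 2 ⁆ ⁆ ⁆ ≈ 𝟘
  e-one 2≤n with e 1 | e-inRange (s≤s z≤n) (≤-trans (s≤s z≤n) 2≤n) | e 2 | e-inRange (s≤s z≤n) 2≤n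
  ... | .(gen i) | generator i idx≡1 | .(gen j) | generator j idx≡2 = rel-one i j idx≡1 idx≡2

  e-adjacent↑ : ∀ k → 2 ≤ k → suc k ≤ n → ⁅ e k , ⁅ e k , e (suc k) ⁆ ⁆ ≈ - (2 × e k)
  e-adjacent↑ k 2≤k k<n = e-adjacent 2≤k (dist-suc k) (≤-trans (n≤1+n k) k<n) (s≤s z≤n) k<n

  e-adjacent↓ : ∀ k → 1 ≤ k → suc k ≤ n → ⁅ e (suc k) , ⁅ e (suc k) , e k ⁆ ⁆ ≈ - (2 × e (suc k))
  e-adjacent↓ k 1≤k k<n =
    e-adjacent (s≤s 1≤k) (≡.trans (dist-sym (suc k) k) (dist-suc k)) k<n 1≤k (≤-trans (n≤1+n k) k<n)

  ad : ℕ → Elt → Elt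
  ad k x = ⁅ e k , x ⁆

  ad-cong : ∀ k {x y} → x ≈ y → ad k x ≈ ad k y
  ad-cong k = br-cong ≈-refl

  ad-zero : ∀ k {x} → x ≈ 𝟘 → ad k x ≈ 𝟘
  ad-zero k x≈𝟘 = ≈-trans (ad-cong k x≈𝟘) (br-zeroʳ _)

  ad-neg : ∀ k x → ad k (- x) ≈ - ad k x
  ad-neg k = br-negʳ (e k)

  ad-× : ∀ k m x → ad k (m × x) ≈ m × ad k x
  ad-× k m = br-×ʳ m (e k)

  ad-split : ∀ k {x y z} → x ≈ y ⊕ z → ad k x ≈ ad k y ⊕ ad k z
  ad-split k x≈y⊕z = ≈-trans (ad-cong k x≈y⊕z) (br-⊕ʳ _ _ _)

  ad-split-neg : ∀ k {x y z} → x ≈ y ⊕ - z → ad k x ≈ ad k y ⊕ - ad k z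
  ad-split-neg k x≈y-z = ≈-trans (ad-split k x≈y-z) (⊕-cong ≈-refl (ad-neg k _))

  ad-comm : ∀ a b x → 2 + a ≤ b → ad a (ad b x) ≈ ad b (ad a x)
  ad-comm a b x a+2≤b = begin
    ad a (ad b x)                          ≈⟨ br-leibniz (e a) (e b) x ⟩
    ⁅ ⁅ e a , e b ⁆ , x ⁆ ⊕ ad b (ad a x)  ≈⟨ ⊕-cong (br-cong (e-far a b a+2≤b) ≈-refl) ≈-refl ⟩
    ⁅ 𝟘 , x ⁆ ⊕ ad b (ad a x)              ≈⟨ ⊕-cong (br-zeroˡ x) ≈-refl ⟩
    𝟘 ⊕ ad b (ad a x)                      ≈⟨ identityˡ _ ⟩
    ad b (ad a x)                          ∎

  ad-br-killed : ∀ k x z → ad k z ≈ 𝟘 → ad k ⁅ x , z ⁆ ≈ ⁅ ad k x , z ⁆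
  ad-br-killed k x z ad-z≈𝟘 = begin
    ad k ⁅ x , z ⁆                     ≈⟨ br-leibniz (e k) x z ⟩
    ⁅ ad k x , z ⁆ ⊕ ⁅ x , ad k z ⁆    ≈⟨ ⊕-cong ≈-refl (≈-trans (br-cong ≈-refl ad-z≈𝟘) (br-zeroʳ x)) ⟩
    ⁅ ad k x , z ⁆ ⊕ 𝟘                 ≈⟨ ⊕-idʳ _ ⟩
    ⁅ ad k x , z ⁆                     ∎

  -- ad applied to the relation [e_a,[e_a,e_b]] = −2 e_a, expanded by the Leibniz rule.
  ad-adjacent : ∀ a b → ⁅ e a , ⁅ e a , e b ⁆ ⁆ ≈ - (2 × e a) → ∀ x →
    ad a (ad a (ad b x)) ⊕ - (2 × ad a (ad b (ad a x))) ⊕ ad b (ad a (ad a x)) ≈ - (2 × ad a x)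
  ad-adjacent a b rel x = solve
    (ad a (ad a (ad b x)) ∷ ad a (ad b (ad a x)) ∷ ad b (ad a (ad a x)) ∷ ad a x
      ∷ ⁅ ⁅ e a , ⁅ e a , e b ⁆ ⁆ , x ⁆ ∷ ad a ⁅ ⁅ e a , e b ⁆ , x ⁆ ∷ ⁅ ⁅ e a , e b ⁆ , ad a x ⁆ ∷ [])
    (v 0 ⊞ ⊟ (2 ⊠ v 1) ⊞ v 2) (⊟ (2 ⊠ v 3))
    ( hyp 1 (v 4) (⊟ (2 ⊠ v 3)) (≈-trans (br-cong rel ≈-refl) (≈-trans (br-negˡ _ x) (⁻¹-cong (br-×ˡ 2 (e a) x))))
    ∷ hyp 1 (v 5) (v 4 ⊞ v 6) (br-leibniz (e a) ⁅ e a , e b ⁆ x)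
    ∷ hyp 1 (v 0) (v 5 ⊞ v 1) (ad-split a (br-leibniz (e a) (e b) x))
    ∷ hyp 1 (v 6 ⊞ v 2) (v 1) (≈-sym (br-leibniz (e a) (e b) (ad a x)))
    ∷ [])

  ad-one : 2 ≤ n → ∀ x →
    ad 1 (ad 1 (ad 1 (ad 2 x))) ⊕ - (3 × ad 1 (ad 1 (ad 2 (ad 1 x))))
      ⊕ 3 × ad 1 (ad 2 (ad 1 (ad 1 x))) ⊕ - ad 2 (ad 1 (ad 1 (ad 1 x))) ≈ 𝟘
  ad-one 2≤n x = solve
    (ad 1 (ad 1 (ad 1 (ad 2 x))) ∷ ad 1 (ad 1 (ad 2 (ad 1 x))) ∷ ad 1 (ad 2 (ad 1 (ad 1 x)))
      ∷ ad 2 (ad 1 (ad 1 (ad 1 x))) ∷ ⁅ g₃ , x ⁆ ∷ ad 1 ⁅ g₂ , x ⁆ ∷ ⁅ g₂ , ad 1 x ⁆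
      ∷ ad 1 (ad 1 ⁅ g₁ , x ⁆) ∷ ad 1 ⁅ g₁ , ad 1 x ⁆ ∷ ⁅ g₁ , ad 1 (ad 1 x) ⁆ ∷ [])
    (v 0 ⊞ ⊟ (3 ⊠ v 1) ⊞ 3 ⊠ v 2 ⊞ ⊟ v 3) ∅
    ( hyp 1 (v 4) ∅ (≈-trans (br-cong (e-one 2≤n) ≈-refl) (br-zeroˡ x))
    ∷ hyp 1 (v 5) (v 4 ⊞ v 6) (br-leibniz (e 1) g₂ x)
    ∷ hyp 1 (v 7) (v 5 ⊞ v 8) (ad-split 1 (br-leibniz (e 1) g₁ x))
    ∷ hyp 1 (v 6 ⊞ v 9) (v 8) (≈-sym (br-leibniz (e 1) g₁ (ad 1 x)))
    ∷ hyp 1 (v 0) (v 7 ⊞ v 1) (ad-split 1 (ad-split 1 (br-leibniz (e 1) (e 2) x)))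
    ∷ hyp 2 (v 8 ⊞ v 2) (v 1) (≈-sym (ad-split 1 (br-leibniz (e 1) (e 2) (ad 1 x))))
    ∷ hyp 1 (v 2) (v 9 ⊞ v 3) (br-leibniz (e 1) (e 2) (ad 1 (ad 1 x)))
    ∷ [])
    where
    g₁ g₂ g₃ : Elt
    g₁ = ⁅ e 1 , e 2 ⁆
    g₂ = ad 1 g₁
    g₃ = ad 1 g₂

  e-adjacent↓′ : ∀ k → 1 ≤ k → suc k ≤ n → ad (suc k) (ad k (e (suc k))) ≈ 2 × e (suc k)
  e-adjacent↓′ k 1≤k k<n = begin
    ad (suc k) (ad k (e (suc k)))          ≈⟨ ad-cong (suc k) (br-antisym _ _) ⟩
    ad (suc k) (- ad (suc k) (e k))        ≈⟨ ad-neg (suc k) _ ⟩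
    - ad (suc k) (ad (suc k) (e k))        ≈⟨ ⁻¹-cong (e-adjacent↓ k 1≤k k<n) ⟩
    - - (2 × e (suc k))                    ≈⟨ ⁻¹-involutive _ ⟩
    2 × e (suc k)                          ∎

  ad-adjacent↑ : ∀ k → 2 ≤ k → suc k ≤ n → ∀ x →
    ad k (ad k (ad (suc k) x)) ⊕ - (2 × ad k (ad (suc k) (ad k x))) ⊕ ad (suc k) (ad k (ad k x))
      ≈ - (2 × ad k x)
  ad-adjacent↑ k 2≤k k<n = ad-adjacent k (suc k) (e-adjacent↑ k 2≤k k<n)

  ad-adjacent↓ : ∀ k → 1 ≤ k → suc k ≤ n → ∀ x →
    ad (suc k) (ad (suc k) (ad k x)) ⊕ - (2 × ad (suc k) (ad k (ad (suc k) x)))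
      ⊕ ad k (ad (suc k) (ad (suc k) x)) ≈ - (2 × ad (suc k) x)
  ad-adjacent↓ k 1≤k k<n = ad-adjacent (suc k) k (e-adjacent↓ k 1≤k k<n)

  chain : ℕ → ℕ → Elt
  chain a zero    = e a
  chain a (suc m) = ad a (chain (suc a) m)

  ad-chain-below : ∀ k a m → 2 + k ≤ a → ad k (chain a m) ≈ 𝟘
  ad-chain-below k a zero    k+2≤a = e-far k a k+2≤a
  ad-chain-below k a (suc m) k+2≤a = begin
    ad k (ad a (chain (suc a) m))  ≈⟨ ad-comm k a _ k+2≤a ⟩
    ad a (ad k (chain (suc a) m))  ≈⟨ ad-zero a (ad-chain-below k (suc a) m (≤-trans k+2≤a (n≤1+n a))) ⟩
    𝟘                              ∎

  ad-chain-above : ∀ k a m → 2 + (m + a) ≤ k → ad k (chain a m) ≈ 𝟘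
  ad-chain-above k a zero    a+2≤k = e-far′ k a a+2≤k
  ad-chain-above k a (suc m) m+a+3≤k = begin
    ad k (ad a (chain (suc a) m))  ≈⟨ ad-comm a k _ (≤-trans (s≤s (s≤s (m≤n+m a (suc m)))) m+a+3≤k) ⟨
    ad a (ad k (chain (suc a) m))  ≈⟨ ad-zero a (ad-chain-above k (suc a) m m+a+3≤k′) ⟩
    𝟘                              ∎
    where
    m+a+3≤k′ : 2 + (m + suc a) ≤ k
    m+a+3≤k′ = ≡.subst (λ j → 2 + j ≤ k) (≡.sym (+-suc m a)) m+a+3≤k

  chain-suc : ∀ a m → chain a (suc m) ≈ ⁅ chain a m , e (suc (m + a)) ⁆
  chain-suc a zero    = ≈-refl
  chain-suc a (suc m) = begin
    ad a (chain (suc a) (suc m))                    ≈⟨ ad-cong a (chain-suc (suc a) m) ⟩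
    ad a ⁅ chain (suc a) m , e (suc (m + suc a)) ⁆  ≡⟨ ≡.cong (λ j → ad a ⁅ chain (suc a) m , e (suc j) ⁆) (+-suc m a) ⟩
    ad a ⁅ chain (suc a) m , e (2 + (m + a)) ⁆      ≈⟨ ad-br-killed a _ _ (e-far a _ (s≤s (s≤s (m≤n+m a m)))) ⟩
    ⁅ chain a (suc m) , e (2 + (m + a)) ⁆            ∎

  ad-chain-next : ∀ a m → ad (suc (m + a)) (chain a m) ≈ - chain a (suc m)
  ad-chain-next a m = ≈-trans (br-antisym _ _) (⁻¹-cong (≈-sym (chain-suc a m)))

  ad²-chain : ∀ k r → 2 ≤ k → suc k ≤ n → ad k (ad k (chain (suc k) (suc r))) ≈ 𝟘
  ad²-chain k r 2≤k k<n = solve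
    (ad k (ad k (ad (suc k) Z)) ∷ ad k (ad (suc k) (ad k Z)) ∷ ad (suc k) (ad k (ad k Z)) ∷ ad k Z ∷ [])
    (v 0) ∅
    ( hyp 1 (v 0 ⊞ ⊟ (2 ⊠ v 1) ⊞ v 2) (⊟ (2 ⊠ v 3)) (ad-adjacent↑ k 2≤k k<n Z)
    ∷ hyp 2 ∅ (v 3) (≈-sym adZ≈𝟘)
    ∷ hyp 2 (v 1) ∅ (ad-zero k (ad-zero (suc k) adZ≈𝟘))
    ∷ hyp 1 ∅ (v 2) (≈-sym (ad-zero (suc k) (ad-zero k adZ≈𝟘)))
    ∷ [])
    where
    Z : Elt
    Z = chain (2 + k) r
    adZ≈𝟘 : ad k Z ≈ 𝟘
    adZ≈𝟘 = ad-chain-below k (2 + k) r ≤-refl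

  index-shift : ∀ d a → 2 + d + suc a ≡ 3 + d + a
  index-shift d a = ≡.cong (2 +_) (+-suc d a)

  ad-chain-step : ∀ d a m {x} → ad (2 + d + suc a) (chain (suc a) m) ≈ x →
                  ad (3 + d + a) (chain a (suc m)) ≈ ad a x
  ad-chain-step d a m {x} ad-chain≈x = begin
    ad (3 + d + a) (ad a (chain (suc a) m))      ≈⟨ ad-comm a (3 + d + a) _ (s≤s (s≤s (m≤n+m a (suc d)))) ⟨
    ad a (ad (3 + d + a) (chain (suc a) m))      ≡⟨ ≡.cong (λ k → ad a (ad k (chain (suc a) m))) (index-shift d a) ⟨
    ad a (ad (2 + d + suc a) (chain (suc a) m))  ≈⟨ ad-cong a ad-chain≈x ⟩
    ad a x                                       ∎


  ad-chain-last : ∀ d a → 2 + d + a ≤ n → ad (2 + d + a) (chain a (2 + d)) ≈ 𝟘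
  ad-chain-last zero a a+2≤n = begin
    ad (2 + a) (ad a (ad (suc a) (e (2 + a))))  ≈⟨ ad-comm a (2 + a) _ ≤-refl ⟨
    ad a (ad (2 + a) (ad (suc a) (e (2 + a))))  ≈⟨ ad-cong a (e-adjacent↓′ (suc a) (s≤s z≤n) a+2≤n) ⟩
    ad a (2 × e (2 + a))                        ≈⟨ ad-× a 2 _ ⟩
    2 × ad a (e (2 + a))                        ≈⟨ ×-congʳ 2 (e-far a (2 + a) ≤-refl) ⟩
    2 × 𝟘                                       ≈⟨ ×-identityʳ 2 ⟩
    𝟘                                           ∎
  ad-chain-last (suc d) a bound =
    ≈-trans (ad-chain-step d a (2 + d) (ad-chain-last d (suc a) (≡.subst (_≤ n) (≡.sym (index-shift d a)) bound)))
            (br-zeroʳ _)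

  -- y 0 is a junk value; for j ≥ 1, y j = [e_1[e_2[⋯[e_{j−1} e_j]⋯].
  y : ℕ → Elt
  y zero    = 𝟘
  y (suc m) = chain 1 m

  ad↓ : ℕ → Elt → Elt
  ad↓ zero    x = x
  ad↓ (suc i) x = ad (suc i) (ad↓ i x)

  u′ : ℕ → ℕ → Elt
  u′ i j = ad↓ i (y j)

  ad↓-cong : ∀ i {x x′} → x ≈ x′ → ad↓ i x ≈ ad↓ i x′
  ad↓-cong zero    x≈x′ = x≈x′
  ad↓-cong (suc i) x≈x′ = ad-cong (suc i) (ad↓-cong i x≈x′)

  ad↓-zero : ∀ i {x} → x ≈ 𝟘 → ad↓ i x ≈ 𝟘
  ad↓-zero zero    x≈𝟘 = x≈𝟘
  ad↓-zero (suc i) x≈𝟘 = ad-zero (suc i) (ad↓-zero i x≈𝟘)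

  ad↓-neg : ∀ i x → ad↓ i (- x) ≈ - ad↓ i x
  ad↓-neg zero    x = ≈-refl
  ad↓-neg (suc i) x = ≈-trans (ad-cong (suc i) (ad↓-neg i x)) (ad-neg (suc i) _)

  ad-ad↓ : ∀ k i x → 2 + i ≤ k → ad k (ad↓ i x) ≈ ad↓ i (ad k x)
  ad-ad↓ k zero    x i+2≤k = ≈-refl
  ad-ad↓ k (suc i) x i+3≤k = begin
    ad k (ad (suc i) (ad↓ i x))  ≈⟨ ad-comm (suc i) k _ i+3≤k ⟨
    ad (suc i) (ad k (ad↓ i x))  ≈⟨ ad-cong (suc i) (ad-ad↓ k i x (≤-trans (n≤1+n _) i+3≤k)) ⟩
    ad (suc i) (ad↓ i (ad k x))  ∎

  ad-u′-zero : ∀ k i j → 2 + i ≤ k → ad k (y j) ≈ 𝟘 → ad k (u′ i j) ≈ 𝟘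
  ad-u′-zero k i j i+2≤k ad-y≈𝟘 = ≈-trans (ad-ad↓ k i _ i+2≤k) (ad↓-zero i ad-y≈𝟘)

  ad-u′-neg : ∀ k i j → 2 + i ≤ k → ad k (y j) ≈ - y k → ad k (u′ i j) ≈ - u′ i k
  ad-u′-neg k i j i+2≤k ad-y≈-y = ≈-trans (ad-ad↓ k i _ i+2≤k) (≈-trans (ad↓-cong i ad-y≈-y) (ad↓-neg i _))

  2+d+1≡3+d : ∀ d → 2 + d + 1 ≡ 3 + d
  2+d+1≡3+d d = ≡.cong (2 +_) (+-comm d 1)

  ad-y-below : ∀ k j → 2 + j ≤ k → ad k (y j) ≈ 𝟘
  ad-y-below k zero    _       = br-zeroʳ _
  ad-y-below k (suc m) m+3≤k = ad-chain-above k 1 m (≡.subst (λ i → 2 + i ≤ k) (+-comm 1 m) m+3≤k)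

  ad-y-next : ∀ j → 1 ≤ j → ad (suc j) (y j) ≈ - y (suc j)
  ad-y-next (suc m) _ =
    ≡.subst (λ k → ad k (chain 1 m) ≈ - chain 1 (suc m)) (≡.cong suc (+-comm m 1)) (ad-chain-next 1 m)

  ad-y-last : ∀ k → 3 ≤ k → k ≤ n → ad k (y k) ≈ 𝟘
  ad-y-last (suc (suc (suc d))) (s≤s (s≤s (s≤s _))) k≤n =
    ≡.subst (λ k → ad k (chain 1 (2 + d)) ≈ 𝟘) (2+d+1≡3+d d)
      (ad-chain-last d 1 (≡.subst (_≤ n) (≡.sym (2+d+1≡3+d d)) k≤n))

  ad↓-br-e : ∀ i x k → 2 + i ≤ k → ad↓ i ⁅ x , e k ⁆ ≈ ⁅ ad↓ i x , e k ⁆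
  ad↓-br-e zero    x k _     = ≈-refl
  ad↓-br-e (suc i) x k i+3≤k = ≈-trans (ad-cong (suc i) (ad↓-br-e i x k (≤-trans (n≤1+n _) i+3≤k)))
                                       (ad-br-killed (suc i) _ _ (e-far (suc i) k i+3≤k))

  u′-suc : ∀ i m → i ≤ m → u′ i (2 + m) ≈ ⁅ u′ i (suc m) , e (2 + m) ⁆
  u′-suc i m i≤m = begin
    ad↓ i (chain 1 (suc m))                        ≈⟨ ad↓-cong i (chain-suc 1 m) ⟩
    ad↓ i ⁅ chain 1 m , e (suc (m + 1)) ⁆         ≡⟨ ≡.cong (λ k → ad↓ i ⁅ chain 1 m , e (suc k) ⁆) (+-comm m 1) ⟩
    ad↓ i ⁅ chain 1 m , e (2 + m) ⁆               ≈⟨ ad↓-br-e i _ (2 + m) (s≤s (s≤s i≤m)) ⟩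
    ⁅ u′ i (suc m) , e (2 + m) ⁆                  ∎

  ad-u′₁₂ : 2 ≤ n → ad 2 (u′ 1 2) ≈ 2 × y 2
  ad-u′₁₂ 2≤n = begin
    ad 2 (ad 1 p)                          ≈⟨ br-leibniz (e 2) (e 1) p ⟩
    ⁅ ⁅ e 2 , e 1 ⁆ , p ⁆ ⊕ ad 1 (ad 2 p)
      ≈⟨ ⊕-cong (br-cong (br-antisym _ _) ≈-refl) (ad-cong 1 (e-adjacent↓′ 1 (s≤s z≤n) 2≤n)) ⟩
    ⁅ - p , p ⁆ ⊕ ad 1 (2 × e 2)
      ≈⟨ ⊕-cong (≈-trans (br-negˡ p p) (≈-trans (⁻¹-cong (br-alt p)) ε⁻¹≈ε)) (ad-× 1 2 _) ⟩
    𝟘 ⊕ 2 × p                              ≈⟨ identityˡ _ ⟩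
    2 × p                                  ∎
    where
    p : Elt
    p = ad 1 (e 2)

  br-ad-u′-e : ∀ t c → 3 + t ≤ n → ⁅ ad (3 + t) (c × u′ t (2 + t)) , e (3 + t) ⁆ ≈ 𝟘
  br-ad-u′-e t c J≤n = begin
    ⁅ ad J (c × u′ t (2 + t)) , e J ⁆   ≈⟨ br-cong (≈-trans (ad-× J c _) (×-congʳ c ad-u′≈-u′)) ≈-refl ⟩
    ⁅ c × - u′ t J , e J ⁆              ≈⟨ ≈-trans (br-×ˡ c _ _) (×-congʳ c (br-negˡ _ _)) ⟩
    c × - ⁅ u′ t J , e J ⁆              ≈⟨ ×-congʳ c (≈-trans (⁻¹-cong (br-antisym _ _)) (⁻¹-involutive _)) ⟩
    c × ad J (u′ t J)                   ≈⟨ ×-congʳ c ad-u′≈𝟘 ⟩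
    c × 𝟘                               ≈⟨ ×-identityʳ c ⟩
    𝟘                                   ∎
    where
    J : ℕ
    J = 3 + t
    ad-u′≈-u′ : ad J (u′ t (2 + t)) ≈ - u′ t J
    ad-u′≈-u′ = ad-u′-neg J t (2 + t) (n≤1+n _) (ad-y-next (2 + t) (s≤s z≤n))
    ad-u′≈𝟘 : ad J (u′ t J) ≈ 𝟘
    ad-u′≈𝟘 = ad-u′-zero J t J (n≤1+n _) (ad-y-last J (s≤s (s≤s (s≤s z≤n))) J≤n)

  ad-u′-self₁ : ∀ r → 2 ≤ n → ad 1 (u′ 1 (3 + r)) ≈ 𝟘
  ad-u′-self₁ r 2≤n = begin
    ad 1 (ad 1 (ad 1 ⁅ e 2 , T ⁆))      ≈⟨ ad-cong 1 (ad-cong 1 (ad-br-killed 1 _ T ad-T≈𝟘)) ⟩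
    ad 1 (ad 1 ⁅ ad 1 (e 2) , T ⁆)      ≈⟨ ad-cong 1 (ad-br-killed 1 _ T ad-T≈𝟘) ⟩
    ad 1 ⁅ ad 1 (ad 1 (e 2)) , T ⁆      ≈⟨ ad-br-killed 1 _ T ad-T≈𝟘 ⟩
    ⁅ ad 1 (ad 1 (ad 1 (e 2))) , T ⁆    ≈⟨ br-cong (e-one 2≤n) ≈-refl ⟩
    ⁅ 𝟘 , T ⁆                           ≈⟨ br-zeroˡ T ⟩
    𝟘                                   ∎
    where
    T : Elt
    T = chain 3 r
    ad-T≈𝟘 : ad 1 T ≈ 𝟘
    ad-T≈𝟘 = ad-chain-below 1 3 r ≤-refl

  ad²-ad-zero : ∀ b x → 1 ≤ b → 2 + b ≤ n →
                ad (suc b) (ad b (ad (suc b) x)) ≈ ad (suc b) x → ad b (ad (suc b) (ad (suc b) x)) ≈ 𝟘 →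
                ad (suc b) (ad (suc b) (ad b x)) ≈ 𝟘
  ad²-ad-zero b x 1≤b b+2≤n zigzag ad-ad²≈𝟘 = solve
    (ad k (ad k (ad b x)) ∷ ad k (ad b (ad k x)) ∷ ad b (ad k (ad k x)) ∷ ad k x ∷ [])
    (v 0) ∅
    ( hyp 1 (v 0 ⊞ ⊟ (2 ⊠ v 1) ⊞ v 2) (⊟ (2 ⊠ v 3)) (ad-adjacent↓ b 1≤b (≤-trans (n≤1+n _) b+2≤n) x)
    ∷ hyp 2 (v 1) (v 3) zigzag
    ∷ hyp 1 ∅ (v 2) (≈-sym ad-ad²≈𝟘)
    ∷ [])
    where
    k : ℕ
    k = suc b

  nest-upFrom : ∀ a m → nest (e a) (mapE (upFrom (suc a) m)) ≡ chain a m
  nest-upFrom a zero    = ≡.refl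
  nest-upFrom a (suc m) = ≡.cong (ad a) (nest-upFrom (suc a) m)

  nest-down : ∀ i m x → nest x (mapE (down i ++ upFrom 1 (suc m))) ≡ ⁅ x , u i (suc m) ⁆
  nest-down zero    m x = ≡.refl
  nest-down (suc i) m x = ≡.refl

  u≡u′ : ∀ i m → u i (suc m) ≡ u′ i (suc m)
  u≡u′ zero    m = nest-upFrom 1 m
  u≡u′ (suc i) m = ≡.trans (nest-down i m (e (suc i))) (≡.cong (ad (suc i)) (u≡u′ i m))

  ∈S-resp : ∀ {x y} → x ≈ y → InSpanS x → InSpanS y
  ∈S-resp x≈y (cs , x≈cs) = cs , ≈-trans (≈-sym x≈y) x≈cs

  ∈S-zero : ∀ {x} → x ≈ 𝟘 → InSpanS x
  ∈S-zero x≈𝟘 = [] , x≈𝟘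

  lincomb-++ : ∀ cs ds → lincomb (cs ++ ds) ≈ lincomb cs ⊕ lincomb ds
  lincomb-++ []             ds = ≈-sym (identityˡ _)
  lincomb-++ ((a , s) ∷ cs) ds = ≈-trans (⊕-cong ≈-refl (lincomb-++ cs ds)) (≈-sym (⊕-assoc _ _ _))

  ∈S-⊕ : ∀ {x y} → InSpanS x → InSpanS y → InSpanS (x ⊕ y)
  ∈S-⊕ (cs , x≈cs) (ds , y≈ds) = cs ++ ds , ≈-trans (⊕-cong x≈cs y≈ds) (≈-sym (lincomb-++ cs ds))

  lincomb-scale : ∀ a cs → a ⊙ lincomb cs ≈ lincomb (map (map₁ (a *ᴷ_)) cs)
  lincomb-scale a []             = ⊙-zeroʳ a
  lincomb-scale a ((b , s) ∷ cs) = ≈-trans (⊙-distˡ a _ _) (⊕-cong (⊙-assoc a b _) (lincomb-scale a cs))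

  ∈S-⊙ : ∀ a {x} → InSpanS x → InSpanS (a ⊙ x)
  ∈S-⊙ a (cs , x≈cs) = map (map₁ (a *ᴷ_)) cs , ≈-trans (⊙-cong KR.refl x≈cs) (lincomb-scale a cs)

  ∈S-u′ : ∀ {i j x} → 1 ≤ i → i < j → j ≤ n → ¬ ((i , j) ≡ (1 , 2)) → x ≈ u′ i j → InSpanS x
  ∈S-u′ {i} {suc m} 1≤i i<j j≤n ij≢12 x≈u′ =
    (1ᴷ , ((i , suc m) , 1≤i , i<j , j≤n , ij≢12)) ∷ [] , (begin
      _                           ≈⟨ x≈u′ ⟩
      u′ i (suc m)                ≡⟨ u≡u′ i m ⟨
      u i (suc m)                 ≈⟨ ⊙-id _ ⟨
      1ᴷ ⊙ u i (suc m)            ≈⟨ ⊕-idʳ _ ⟨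
      1ᴷ ⊙ u i (suc m) ⊕ 𝟘        ∎)

  ∈S-neg-u′ : ∀ {i j x} → 1 ≤ i → i < j → j ≤ n → ¬ ((i , j) ≡ (1 , 2)) → x ≈ - u′ i j → InSpanS x
  ∈S-neg-u′ 1≤i i<j j≤n ij≢12 x≈-u′ =
    ∈S-resp (≈-sym x≈-u′) (∈S-⊙ (-ᴷ 1ᴷ) (∈S-u′ 1≤i i<j j≤n ij≢12 ≈-refl))

  ≢12 : ∀ {i j} → 3 ≤ j → ¬ ((i , j) ≡ (1 , 2))
  ≢12 (s≤s (s≤s ())) ≡.refl

  module _ (charZero : CharZero K) where

    solve-cancel : ∀ {m} (ρ : Vec Elt m) w .{{_ : NonZero w}} (L R : Expr m) (hs : List (Hypothesis ρ)) →
                   {_ : True (balanced? (normalise (w ⊠ (L ⊞ ⊟ R) ⊞ ⊟ combination hs)))} →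
                   ⟦ L ⟧ ρ ≈ ⟦ R ⟧ ρ
    solve-cancel ρ w L R hs {bal} = x∙y⁻¹≈ε⇒x≈y _ _ (×-cancel charZero w (solve-× ρ w L R hs {bal}))

    ad-zigzag : ∀ a x → 1 ≤ a → suc a ≤ n → ad a x ≈ 𝟘 → ad (suc a) (ad (suc a) x) ≈ 𝟘 →
                ad (suc a) (ad a (ad (suc a) x)) ≈ ad (suc a) x
    ad-zigzag a x 1≤a a<n ad-x≈𝟘 ad²-x≈𝟘 = solve-cancel
      (ad (suc a) (ad a (ad (suc a) x)) ∷ ad (suc a) (ad (suc a) (ad a x)) ∷ ad a (ad (suc a) (ad (suc a) x))
        ∷ ad (suc a) x ∷ [])
      2 (v 0) (v 3)
      ( hyp 1 (⊟ (2 ⊠ v 3)) (v 1 ⊞ ⊟ (2 ⊠ v 0) ⊞ v 2) (≈-sym (ad-adjacent↓ a 1≤a a<n x))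
      ∷ hyp 1 (v 1) ∅ (ad-zero (suc a) (ad-zero (suc a) ad-x≈𝟘))
      ∷ hyp 1 (v 2) ∅ (ad-zero a ad²-x≈𝟘)
      ∷ [])

    ad-zigzag-e : ∀ a → 1 ≤ a → 2 + a ≤ n →
                  ad (suc a) (ad a (ad (suc a) (e (2 + a)))) ≈ ad (suc a) (e (2 + a)) ⊕ - ad a (e (suc a))
    ad-zigzag-e a 1≤a a+2≤n = solve-cancel
      (ad (suc a) (ad a (ad (suc a) x)) ∷ ad (suc a) (ad (suc a) (ad a x)) ∷ ad a (ad (suc a) (ad (suc a) x))
        ∷ ad (suc a) x ∷ ad a (e (suc a)) ∷ [])
      2 (v 0) (v 3 ⊞ ⊟ v 4)
      ( hyp 1 (⊟ (2 ⊠ v 3)) (v 1 ⊞ ⊟ (2 ⊠ v 0) ⊞ v 2) (≈-sym (ad-adjacent↓ a 1≤a (≤-trans (n≤1+n _) a+2≤n) x))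
      ∷ hyp 1 (v 1) ∅ (ad-zero (suc a) (ad-zero (suc a) (e-far a (2 + a) ≤-refl)))
      ∷ hyp 1 (v 2) (⊟ (2 ⊠ v 4)) (≈-trans (ad-cong a (e-adjacent↑ (suc a) (s≤s 1≤a) a+2≤n))
                                           (≈-trans (ad-neg a _) (⁻¹-cong (ad-× a 2 _))))
      ∷ [])
      where
      x : Elt
      x = e (2 + a)

    ad-chain-penultimate : ∀ d a → 3 + d + a ≤ n → ad (2 + d + a) (chain a (3 + d)) ≈ - chain a (2 + d)
    ad-chain-penultimate zero a a+3≤n = begin
      ad (2 + a) (ad a (chain (suc a) 2))                         ≈⟨ ad-comm a (2 + a) _ ≤-refl ⟨
      ad a (ad (2 + a) (ad (suc a) (ad (2 + a) (e (3 + a)))))      ≈⟨ ad-split a (ad-zigzag-e (suc a) (s≤s z≤n) a+3≤n) ⟩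
      ad a (chain (2 + a) 1) ⊕ ad a (- chain (suc a) 1)          ≈⟨ ⊕-cong (ad-chain-below a (2 + a) 1 ≤-refl) (ad-neg a _) ⟩
      𝟘 ⊕ - chain a 2                                            ≈⟨ identityˡ _ ⟩
      - chain a 2                                                ∎
    ad-chain-penultimate (suc d) a bound = ≈-trans
      (ad-chain-step d a (3 + d)
        (ad-chain-penultimate d (suc a) (≡.subst (λ k → suc k ≤ n) (≡.sym (index-shift d a)) bound)))
      (ad-neg a _)

    ad-chain-interior : ∀ d a r → 3 + d + a ≤ n → ad (2 + d + a) (chain a (4 + d + r)) ≈ 𝟘
    ad-chain-interior zero a r a+3≤n = begin
      ad (2 + a) (ad a (chain (suc a) (3 + r)))                  ≈⟨ ad-comm a (2 + a) _ ≤-refl ⟨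
      ad a (ad (2 + a) (ad (suc a) (ad (2 + a) x)))              ≈⟨ ad-cong a (ad-zigzag (suc a) x (s≤s z≤n) (≤-trans (n≤1+n _) a+3≤n)
                                                                      (ad-chain-below (suc a) (3 + a) (suc r) ≤-refl)
                                                                      (ad²-chain (2 + a) r (s≤s (s≤s z≤n)) a+3≤n)) ⟩
      ad a (chain (2 + a) (2 + r))                                ≈⟨ ad-chain-below a (2 + a) (2 + r) ≤-refl ⟩
      𝟘                                                          ∎
      where
      x : Elt
      x = chain (3 + a) (suc r)
    ad-chain-interior (suc d) a r bound = ≈-trans
      (ad-chain-step d a (4 + d + r)
        (ad-chain-interior d (suc a) r (≡.subst (λ k → suc k ≤ n) (≡.sym (index-shift d a)) bound)))
      (br-zeroʳ _)

    ad-y-penultimate : ∀ k → 3 ≤ k → suc k ≤ n → ad k (y (suc k)) ≈ - y k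
    ad-y-penultimate (suc (suc (suc d))) (s≤s (s≤s (s≤s _))) k<n =
      ≡.subst (λ k → ad k (chain 1 (3 + d)) ≈ - chain 1 (2 + d)) (2+d+1≡3+d d)
        (ad-chain-penultimate d 1 (≡.subst (λ k → suc k ≤ n) (≡.sym (2+d+1≡3+d d)) k<n))

    ad-y-interior : ∀ k j → 3 ≤ k → 2 + k ≤ j → j ≤ n → ad k (y j) ≈ 𝟘
    ad-y-interior k@(suc (suc (suc d))) j (s≤s (s≤s (s≤s _))) k+2≤j j≤n with m≤n⇒∃[o]m+o≡n k+2≤j
    ... | r , ≡.refl = ≡.subst (λ k → ad k (chain 1 (4 + d + r)) ≈ 𝟘) (2+d+1≡3+d d)
      (ad-chain-interior d 1 r (≡.subst (λ k → suc k ≤ n) (≡.sym (2+d+1≡3+d d)) k<n))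
      where
      k<n : suc k ≤ n
      k<n = ≤-trans (≤-trans (n≤1+n (suc k)) (m≤m+n (2 + k) r)) j≤n

    -- With g = u_{J−2,J−1} and V = u_{J−2,J} = [g, e_J], expanding X = ad_J ad_{J−1} [g, e_J]
    -- by the Leibniz rule gives X = 0 + 0 − X + 2 V.
    ad-u′-diagonal-step : ∀ t → 3 + t ≤ n →
      ⁅ ad (3 + t) (ad (2 + t) (u′ (1 + t) (2 + t))) , e (3 + t) ⁆ ≈ 𝟘 →
      ad (3 + t) (u′ (2 + t) (3 + t)) ≈ u′ (1 + t) (3 + t)
    ad-u′-diagonal-step t J≤n first-term≈𝟘 = solve-cancel
      ( ad J (ad s V) ∷ V ∷ ⁅ g , e J ⁆ ∷ ad J (ad s ⁅ g , e J ⁆)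
      ∷ ad J ⁅ ad s g , e J ⁆ ∷ ad J ⁅ g , ad s (e J) ⁆
      ∷ ⁅ ad J (ad s g) , e J ⁆ ∷ ⁅ ad s g , ad J (e J) ⁆ ∷ ⁅ ad J g , ad s (e J) ⁆ ∷ ⁅ g , ad J (ad s (e J)) ⁆
      ∷ ⁅ V , ad s (e J) ⁆ ∷ ⁅ ad s (e J) , V ⁆ ∷ ad s (ad J V) ∷ [])
      2 (v 0) (v 1)
      ( hyp 2 (v 2) (v 1) (≈-sym V≈[g,e])
      ∷ hyp 1 (v 0) (v 3) (ad-cong J (ad-cong s V≈[g,e]))
      ∷ hyp 1 (v 3) (v 4 ⊞ v 5) (ad-split J (br-leibniz (e s) g (e J)))
      ∷ hyp 1 (v 4) (v 6 ⊞ v 7) (br-leibniz (e J) (ad s g) (e J))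
      ∷ hyp 1 (v 5) (v 8 ⊞ v 9) (br-leibniz (e J) g (ad s (e J)))
      ∷ hyp 1 (v 6) ∅ first-term≈𝟘
      ∷ hyp 1 (v 7) ∅ (≈-trans (br-cong ≈-refl (br-alt (e J))) (br-zeroʳ _))
      ∷ hyp 1 (v 8) (⊟ v 10)
          (≈-trans (br-cong (ad-u′-neg J (1 + t) s ≤-refl (ad-y-next (2 + t) (s≤s z≤n))) ≈-refl) (br-negˡ _ _))
      ∷ hyp 1 (v 9) (2 ⊠ v 2) (≈-trans (br-cong ≈-refl (e-adjacent↓′ s (s≤s z≤n) J≤n)) (br-×ʳ 2 _ _))
      ∷ hyp 1 (⊟ v 11) (v 10) (≈-sym (br-antisym V (ad s (e J))))
      ∷ hyp 1 (v 11 ⊞ v 0) (v 12) (≈-sym (br-leibniz (e s) (e J) V))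
      ∷ hyp 1 (v 12) ∅ (ad-zero s (ad-u′-zero J (1 + t) J ≤-refl (ad-y-last J (s≤s (s≤s (s≤s z≤n))) J≤n)))
      ∷ [])
      where
      J s : ℕ
      J = 3 + t
      s = 2 + t
      g V : Elt
      g = u′ (1 + t) s
      V = u′ (1 + t) J
      V≈[g,e] : V ≈ ⁅ g , e J ⁆
      V≈[g,e] = u′-suc (1 + t) (suc t) ≤-refl

    ad-u′-diagonal : ∀ t → 3 + t ≤ n → ad (3 + t) (u′ (2 + t) (3 + t)) ≈ u′ (1 + t) (3 + t)
    ad-u′-diagonal t J≤n = ad-u′-diagonal-step t J≤n (first-term≈𝟘 t J≤n)
      where
      first-term≈𝟘 : ∀ t → 3 + t ≤ n → ⁅ ad (3 + t) (ad (2 + t) (u′ (1 + t) (2 + t))) , e (3 + t) ⁆ ≈ 𝟘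
      first-term≈𝟘 zero    J≤n = ≈-trans (br-cong (ad-cong 3 (ad-u′₁₂ (≤-trans (n≤1+n 2) J≤n))) ≈-refl) (br-ad-u′-e 0 2 J≤n)
      first-term≈𝟘 (suc t) J≤n = ≈-trans
        (br-cong (ad-cong (4 + t) (≈-trans (ad-u′-diagonal t (≤-trans (n≤1+n _) J≤n)) (≈-sym (⊕-idʳ _)))) ≈-refl)
        (br-ad-u′-e (suc t) 1 J≤n)

    ad₂-y : ∀ r → 3 ≤ n → ad 2 (y (4 + r)) ≈ chain 2 (2 + r)
    ad₂-y r 3≤n = ad-zigzag 1 (chain 3 (suc r)) (s≤s z≤n) (≤-trans (n≤1+n 2) 3≤n)
                    (ad-chain-below 1 3 (suc r) ≤-refl) (ad²-chain 2 r (s≤s (s≤s z≤n)) 3≤n)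

    ad-u′-self₂ : ∀ j → 3 ≤ j → j ≤ n → ad 2 (u′ 2 j) ≈ 𝟘
    ad-u′-self₂ 1 (s≤s ()) _
    ad-u′-self₂ 2 (s≤s (s≤s ())) _
    ad-u′-self₂ 3 _ 3≤n = solve
      ( ad 2 (ad 2 (ad 1 x)) ∷ ad 2 (ad 1 (ad 2 x)) ∷ ad 1 (ad 2 (ad 2 x)) ∷ ad 2 x ∷ ad 1 (e 2)
      ∷ ad 2 (ad 1 (ad 1 (e 2))) ∷ ad 1 (ad 2 (ad 2 (e 3))) ∷ ad 1 (ad 2 (ad 1 (e 2))) ∷ [])
      (v 0) ∅
      ( hyp 1 (v 0 ⊞ ⊟ (2 ⊠ v 1) ⊞ v 2) (⊟ (2 ⊠ v 3)) (ad-adjacent↓ 1 (s≤s z≤n) (≤-trans (n≤1+n 2) 3≤n) x)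
      ∷ hyp 2 (v 1) (v 3 ⊞ ⊟ v 5) (ad-split-neg 2 (ad-split-neg 1 ad-x))
      ∷ hyp 2 (2 ⊠ v 4) (v 5) (≈-sym (ad-u′₁₂ (≤-trans (n≤1+n 2) 3≤n)))
      ∷ hyp 1 (v 6 ⊞ ⊟ v 7) (v 2) (≈-sym (ad-split-neg 1 (ad-split-neg 2 ad-x)))
      ∷ hyp 1 (⊟ (2 ⊠ v 4)) (v 6)
          (≈-sym (≈-trans (ad-cong 1 (e-adjacent↑ 2 (s≤s (s≤s z≤n)) 3≤n)) (≈-trans (ad-neg 1 _) (⁻¹-cong (ad-× 1 2 _)))))
      ∷ hyp 1 (v 7) (2 ⊠ v 4) (≈-trans (ad-cong 1 (e-adjacent↓′ 1 (s≤s z≤n) (≤-trans (n≤1+n 2) 3≤n))) (ad-× 1 2 _))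
      ∷ [])
      where
      x : Elt
      x = y 3
      ad-x : ad 2 x ≈ ad 2 (e 3) ⊕ - ad 1 (e 2)
      ad-x = ad-zigzag-e 1 (s≤s z≤n) 3≤n
    ad-u′-self₂ (suc (suc (suc (suc r)))) _ j≤n =
      ad²-ad-zero 1 (y (4 + r)) (s≤s z≤n) 3≤n (ad-cong 2 (ad-cong 1 (ad₂-y r 3≤n)))
        (≈-trans (ad-cong 1 (ad-cong 2 (ad₂-y r 3≤n))) (ad-zero 1 (ad²-chain 2 r (s≤s (s≤s z≤n)) 3≤n)))
      where
      3≤n : 3 ≤ n
      3≤n = ≤-trans (s≤s (s≤s (s≤s z≤n))) j≤n

    ad-u′-self₃ : ∀ s j → 4 + s ≤ j → j ≤ n → ad (3 + s) (u′ (3 + s) j) ≈ 𝟘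
    ad-u′-self₃ s j k<j j≤n with m≤n⇒m<n∨m≡n k<j
    ... | inj₂ ≡.refl = ad²-ad-zero b V (s≤s z≤n) j≤n
      (begin
        ad k (ad b (ad k V))   ≈⟨ ad-cong k (ad-cong b ad-V) ⟩
        ad k (ad b (- U))      ≈⟨ ≈-trans (ad-cong k (ad-neg b U)) (ad-neg k _) ⟩
        - ad k (ad b U)        ≈⟨ ⁻¹-cong (ad-u′-diagonal s (≤-trans (n≤1+n _) j≤n)) ⟩
        - U                    ≈⟨ ad-V ⟨
        ad k V                 ∎)
      (begin
        ad b (ad k (ad k V))   ≈⟨ ad-cong b (ad-cong k ad-V) ⟩
        ad b (ad k (- U))      ≈⟨ ad-cong b (ad-neg k U) ⟩
        ad b (- ad k U)        ≈⟨ ad-zero b (≈-trans (⁻¹-cong ad-U) ε⁻¹≈ε) ⟩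
        𝟘                      ∎)
      where
      k b : ℕ
      k = 3 + s
      b = 2 + s
      U V : Elt
      U = u′ (1 + s) k
      V = u′ (1 + s) (suc k)
      ad-V : ad k V ≈ - U
      ad-V = ad-u′-neg k (1 + s) (suc k) ≤-refl (ad-y-penultimate k (s≤s (s≤s (s≤s z≤n))) j≤n)
      ad-U : ad k U ≈ 𝟘
      ad-U = ad-u′-zero k (1 + s) k ≤-refl (ad-y-last k (s≤s (s≤s (s≤s z≤n))) (≤-trans (n≤1+n _) j≤n))
    ... | inj₁ k+2≤j = ad²-ad-zero b V (s≤s z≤n) (≤-trans k<j j≤n)
      (≈-trans (ad-zero k (ad-zero b ad-V)) (≈-sym ad-V))
      (ad-zero b (ad-zero k ad-V))
      where
      k b : ℕ
      k = 3 + s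
      b = 2 + s
      V : Elt
      V = u′ (1 + s) j
      ad-V : ad k V ≈ 𝟘
      ad-V = ad-u′-zero k (1 + s) j ≤-refl (ad-y-interior k j (s≤s (s≤s (s≤s z≤n))) k+2≤j j≤n)

    ad-u′-self≥2 : ∀ k j → 2 ≤ k → suc k ≤ j → j ≤ n → ad k (u′ k j) ≈ 𝟘
    ad-u′-self≥2 1                   j (s≤s ()) _ _
    ad-u′-self≥2 2                   j _ k<j j≤n = ad-u′-self₂ j k<j j≤n
    ad-u′-self≥2 (suc (suc (suc s))) j _ k<j j≤n = ad-u′-self₃ s j k<j j≤n

    ad-u′-lower₁-step : ∀ w → 2 ≤ n →
      ad 1 (ad 1 (ad 1 (ad 2 w))) ≈ 𝟘 → ad 2 (ad 1 (ad 1 (ad 1 w))) ≈ 𝟘 →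
      ad 1 (ad 1 (ad 2 (ad 1 w))) ≈ ad 1 (ad 1 w) →
      ad 1 (ad 2 (ad 1 (ad 1 w))) ≈ ad 1 (ad 1 w)
    ad-u′-lower₁-step w 2≤n ad₁³ad₂≈𝟘 ad₂ad₁³≈𝟘 ad₁²ad₂ad₁≈ad₁² = solve-cancel
      ( ad 1 (ad 1 (ad 1 (ad 2 w))) ∷ ad 1 (ad 1 (ad 2 (ad 1 w))) ∷ ad 1 (ad 2 (ad 1 (ad 1 w)))
      ∷ ad 2 (ad 1 (ad 1 (ad 1 w))) ∷ ad 1 (ad 1 w) ∷ [])
      3 (v 2) (v 4)
      ( hyp 1 (v 0 ⊞ ⊟ (3 ⊠ v 1) ⊞ 3 ⊠ v 2 ⊞ ⊟ v 3) ∅ (ad-one 2≤n w)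
      ∷ hyp 1 ∅ (v 0) (≈-sym ad₁³ad₂≈𝟘)
      ∷ hyp 1 (v 3) ∅ ad₂ad₁³≈𝟘
      ∷ hyp 3 (v 1) (v 4) ad₁²ad₂ad₁≈ad₁²
      ∷ [])

    ad-u′-lower₁ : ∀ j → 3 ≤ j → j ≤ n → ad 1 (u′ 2 j) ≈ u′ 1 j
    ad-u′-lower₁ 1 (s≤s ()) _
    ad-u′-lower₁ 2 (s≤s (s≤s ())) _
    ad-u′-lower₁ 3 _ 3≤n = ad-u′-lower₁-step (ad 2 (e 3)) 2≤n
      (begin
        ad 1 (ad 1 (ad 1 (ad 2 (ad 2 (e 3)))))   ≈⟨ ad-cong 1 (ad-cong 1 (ad-cong 1 (e-adjacent↑ 2 (s≤s (s≤s z≤n)) 3≤n))) ⟩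
        ad 1 (ad 1 (ad 1 (- (2 × e 2))))         ≈⟨ ad-cong 1 (ad-cong 1 (≈-trans (ad-neg 1 _) (⁻¹-cong (ad-× 1 2 _)))) ⟩
        ad 1 (ad 1 (- (2 × ad 1 (e 2))))         ≈⟨ ad-cong 1 (≈-trans (ad-neg 1 _) (⁻¹-cong (ad-× 1 2 _))) ⟩
        ad 1 (- (2 × ad 1 (ad 1 (e 2))))         ≈⟨ ≈-trans (ad-neg 1 _) (⁻¹-cong (ad-× 1 2 _)) ⟩
        - (2 × ad 1 (ad 1 (ad 1 (e 2))))         ≈⟨ ⁻¹-cong (×-congʳ 2 (e-one 2≤n)) ⟩
        - (2 × 𝟘)                               ≈⟨ ≈-trans (⁻¹-cong (×-identityʳ 2)) ε⁻¹≈ε ⟩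
        𝟘                                       ∎)
      (ad-zero 2 (ad-u′-self₁ 0 2≤n))
      (≈-trans (ad-split-neg 1 (ad-split-neg 1 (ad-zigzag-e 1 (s≤s z≤n) 3≤n)))
               (≈-trans (⊕-cong ≈-refl (≈-trans (⁻¹-cong (e-one 2≤n)) ε⁻¹≈ε)) (⊕-idʳ _)))
      where
      2≤n : 2 ≤ n
      2≤n = ≤-trans (n≤1+n 2) 3≤n
    ad-u′-lower₁ (suc (suc (suc (suc r)))) _ j≤n = ad-u′-lower₁-step (chain 2 (2 + r)) 2≤n
      (ad-zero 1 (ad-zero 1 (ad-zero 1 (ad²-chain 2 r (s≤s (s≤s z≤n)) 3≤n))))
      (ad-zero 2 (ad-u′-self₁ (suc r) 2≤n))
      (ad-cong 1 (ad-cong 1 (ad₂-y r 3≤n)))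
      where
      3≤n : 3 ≤ n
      3≤n = ≤-trans (s≤s (s≤s (s≤s z≤n))) j≤n
      2≤n : 2 ≤ n
      2≤n = ≤-trans (n≤1+n 2) 3≤n

    ad-u′-lower₂ : ∀ s j → 4 + s ≤ j → j ≤ n → ad (2 + s) (u′ (3 + s) j) ≈ u′ (2 + s) j
    ad-u′-lower₂ s j k+2≤j j≤n = solve-cancel
      (ad k (ad k (ad k₊ V)) ∷ ad k (ad k₊ (ad k V)) ∷ ad k₊ (ad k (ad k V)) ∷ ad k V ∷ [])
      2 (v 1) (v 3)
      ( hyp 1 (⊟ (2 ⊠ v 3)) (v 0 ⊞ ⊟ (2 ⊠ v 1) ⊞ v 2)
          (≈-sym (ad-adjacent↑ k (s≤s (s≤s z≤n)) (≤-trans (≤-trans (n≤1+n _) k+2≤j) j≤n) V))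
      ∷ hyp 1 (v 2) ∅ (ad-zero k₊ (ad-u′-self≥2 k j (s≤s (s≤s z≤n)) (≤-trans (n≤1+n _) k+2≤j) j≤n))
      ∷ hyp 1 (v 0) ∅ ad²-ad-V≈𝟘
      ∷ [])
      where
      k k₊ : ℕ
      k = 2 + s
      k₊ = 3 + s
      V : Elt
      V = u′ (1 + s) j
      ad²-ad-V≈𝟘 : ad k (ad k (ad k₊ V)) ≈ 𝟘
      ad²-ad-V≈𝟘 with m≤n⇒m<n∨m≡n k+2≤j
      ... | inj₂ ≡.refl = begin
        ad k (ad k (ad k₊ V))
          ≈⟨ ad-cong k (ad-cong k (ad-u′-neg k₊ (1 + s) j ≤-refl (ad-y-penultimate k₊ (s≤s (s≤s (s≤s z≤n))) j≤n))) ⟩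
        ad k (ad k (- u′ (1 + s) k₊))  ≈⟨ ≈-trans (ad-cong k (ad-neg k _)) (ad-neg k _) ⟩
        - ad k (u′ k k₊)          ≈⟨ ⁻¹-cong (ad-u′-self≥2 k k₊ (s≤s (s≤s z≤n)) ≤-refl (≤-trans (n≤1+n _) j≤n)) ⟩
        - 𝟘                      ≈⟨ ε⁻¹≈ε ⟩
        𝟘                        ∎
      ... | inj₁ k₊+2≤j =
        ad-zero k (ad-zero k (ad-u′-zero k₊ (1 + s) j ≤-refl (ad-y-interior k₊ j (s≤s (s≤s (s≤s z≤n))) k₊+2≤j j≤n)))

    ad-u′-lower : ∀ k j → 1 ≤ k → 2 + k ≤ j → j ≤ n → ad k (u′ (suc k) j) ≈ u′ k j
    ad-u′-lower 1               j _ k+2≤j j≤n = ad-u′-lower₁ j k+2≤j j≤n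
    ad-u′-lower (suc (suc s))   j _ k+2≤j j≤n = ad-u′-lower₂ s j k+2≤j j≤n

    ad-u′-two-below : ∀ k → 1 ≤ k → 3 + k ≤ n → ad k (u′ (2 + k) (3 + k)) ≈ - u′ k (2 + k)
    ad-u′-two-below k 1≤k j≤n = begin
      ad k (ad (2 + k) (u′ (suc k) (3 + k)))   ≈⟨ ad-comm k (2 + k) _ ≤-refl ⟩
      ad (2 + k) (ad k (u′ (suc k) (3 + k)))   ≈⟨ ad-cong (2 + k) (ad-u′-lower k (3 + k) 1≤k (n≤1+n _) j≤n) ⟩
      ad (2 + k) (u′ k (3 + k))                ≈⟨ ad-u′-neg (2 + k) k (3 + k) ≤-refl (ad-y-penultimate (2 + k) (s≤s (s≤s 1≤k)) j≤n) ⟩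
      - u′ k (2 + k)                           ∎

    ad-u′-far-below : ∀ k i j → 1 ≤ k → 2 + k ≤ i → 4 + k ≤ j → j ≤ n → ad k (u′ i j) ≈ 𝟘
    ad-u′-far-below k (suc i) j 1≤k k+2≤i+1 k+4≤j j≤n with m≤n⇒m<n∨m≡n k+2≤i+1
    ... | inj₂ ≡.refl = begin
      ad k (ad (2 + k) (u′ (suc k) j))   ≈⟨ ad-comm k (2 + k) _ ≤-refl ⟩
      ad (2 + k) (ad k (u′ (suc k) j))   ≈⟨ ad-cong (2 + k) (ad-u′-lower k j 1≤k (≤-trans (n≤1+n _) (≤-trans (n≤1+n _) k+4≤j)) j≤n) ⟩
      ad (2 + k) (u′ k j)                ≈⟨ ad-u′-zero (2 + k) k j ≤-refl (ad-y-interior (2 + k) j (s≤s (s≤s 1≤k)) k+4≤j j≤n) ⟩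
      𝟘                                  ∎
    ... | inj₁ (s≤s k+2≤i) = begin
      ad k (ad (suc i) (u′ i j))         ≈⟨ ad-comm k (suc i) _ (≤-trans k+2≤i (n≤1+n i)) ⟩
      ad (suc i) (ad k (u′ i j))         ≈⟨ ad-zero (suc i) (ad-u′-far-below k i j 1≤k k+2≤i k+4≤j j≤n) ⟩
      𝟘                                  ∎

    ad-u′∈S-above : ∀ k i j → 3 ≤ k → 2 + i ≤ k → k ≤ n → 1 ≤ i → i < j → j ≤ n → InSpanS (ad k (u′ i j))
    ad-u′∈S-above k i j 3≤k i+2≤k k≤n 1≤i i<j j≤n with position j k
    ... | far-below j+2≤k    = ∈S-zero (ad-u′-zero k i j i+2≤k (ad-y-below k j j+2≤k))
    ... | just-below ≡.refl  = ∈S-neg-u′ 1≤i (≤-trans (n≤1+n _) i+2≤k) k≤n (≢12 3≤k)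
                                 (ad-u′-neg k i j i+2≤k (ad-y-next j (≤-trans (≤-trans 1≤i (n≤1+n i)) i<j)))
    ... | equal ≡.refl       = ∈S-zero (ad-u′-zero k i j i+2≤k (ad-y-last k 3≤k k≤n))
    ... | just-above ≡.refl  = ∈S-neg-u′ 1≤i (≤-trans (n≤1+n _) i+2≤k) k≤n (≢12 3≤k)
                                 (ad-u′-neg k i j i+2≤k (ad-y-penultimate k 3≤k j≤n))
    ... | far-above k+2≤j    = ∈S-zero (ad-u′-zero k i j i+2≤k (ad-y-interior k j 3≤k k+2≤j j≤n))

    ad-u′∈S-far-below : ∀ k i j → 1 ≤ k → 2 + k ≤ i → i < j → j ≤ n → InSpanS (ad k (u′ i j))
    ad-u′∈S-far-below k i j 1≤k k+2≤i i<j j≤n with m≤n⇒m<n∨m≡n (≤-trans (s≤s k+2≤i) i<j)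
    ... | inj₁ k+4≤j = ∈S-zero (ad-u′-far-below k i j 1≤k k+2≤i k+4≤j j≤n)
    ... | inj₂ ≡.refl with ≤-antisym k+2≤i (≤-pred i<j)
    ...   | ≡.refl = ∈S-neg-u′ 1≤k (n≤1+n _) (≤-trans (n≤1+n _) j≤n) (≢12 (s≤s (s≤s 1≤k)))
                       (ad-u′-two-below k 1≤k j≤n)

    ad-u′-self : ∀ i j → 1 ≤ i → i < j → j ≤ n → ¬ ((i , j) ≡ (1 , 2)) → ad i (u′ i j) ≈ 𝟘
    ad-u′-self 1             1                   _ (s≤s ()) _ _
    ad-u′-self 1             2                   _ _ _ ij≢12   = contradiction ≡.refl ij≢12
    ad-u′-self 1             (suc (suc (suc r))) _ _ j≤n _     = ad-u′-self₁ r (≤-trans (s≤s (s≤s z≤n)) j≤n)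
    ad-u′-self (suc (suc s)) j                   _ i<j j≤n _   = ad-u′-self≥2 (2 + s) j (s≤s (s≤s z≤n)) i<j j≤n

    ad-u′∈S-next : ∀ i j → 1 ≤ i → i < j → j ≤ n → suc i ≤ n → ¬ ((i , j) ≡ (1 , 2)) →
                   InSpanS (ad (suc i) (u′ i j))
    ad-u′∈S-next i j 1≤i i<j j≤n k≤n ij≢12 with m≤n⇒m<n∨m≡n i<j
    ... | inj₁ k<j    = ∈S-u′ (s≤s z≤n) k<j j≤n (≢12 (≤-trans (s≤s (s≤s 1≤i)) k<j)) ≈-refl
    ... | inj₂ ≡.refl = diagonal∈S i 1≤i ij≢12 k≤n
      where
      diagonal∈S : ∀ i → 1 ≤ i → ¬ ((i , suc i) ≡ (1 , 2)) → suc i ≤ n →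
                   InSpanS (ad (suc i) (u′ i (suc i)))
      diagonal∈S 1             _ ij≢12 _   = contradiction ≡.refl ij≢12
      diagonal∈S (suc (suc t)) _ _     k≤n =
        ∈S-u′ (s≤s z≤n) (n≤1+n _) k≤n (≢12 (s≤s (s≤s (s≤s z≤n)))) (ad-u′-diagonal t k≤n)

    ad-u′∈S : ∀ k i j → 1 ≤ k → k ≤ n → 1 ≤ i → i < j → j ≤ n → ¬ ((i , j) ≡ (1 , 2)) →
              InSpanS (ad k (u′ i j))
    ad-u′∈S k i j 1≤k k≤n 1≤i i<j j≤n ij≢12 with position k i
    ... | far-below k+2≤i   = ad-u′∈S-far-below k i j 1≤k k+2≤i i<j j≤n
    ... | just-below ≡.refl =
      ∈S-u′ 1≤k (≤-trans (n≤1+n _) i<j) j≤n (≢12 (≤-trans (s≤s (s≤s 1≤k)) i<j)) (ad-u′-lower k j 1≤k i<j j≤n)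
    ... | equal ≡.refl      = ∈S-zero (ad-u′-self k j 1≤k i<j j≤n ij≢12)
    ... | just-above ≡.refl = ad-u′∈S-next i j 1≤i i<j j≤n k≤n ij≢12
    ... | far-above i+2≤k   = ad-u′∈S-above k i j (≤-trans (s≤s (s≤s 1≤i)) i+2≤k) i+2≤k k≤n 1≤i i<j j≤n

    br-gen-uS∈S : ∀ k s → InSpanS ⁅ gen k , uS s ⁆
    br-gen-uS∈S k ((i , suc m) , 1≤i , i<j , j≤n , ij≢12) =
      ∈S-resp (br-cong (≡⇒≈ (e-idx k)) (≡⇒≈ (≡.sym (u≡u′ i m))))
              (ad-u′∈S (idx k) i (suc m) (s≤s z≤n) (toℕ<n k) 1≤i i<j j≤n ij≢12)

    br-lincomb∈S : ∀ x cs → (∀ s → InSpanS ⁅ x , uS s ⁆) → InSpanS ⁅ x , lincomb cs ⁆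
    br-lincomb∈S x []             _         = ∈S-zero (br-zeroʳ x)
    br-lincomb∈S x ((a , s) ∷ cs) br-uS∈S =
      ∈S-resp (≈-sym (≈-trans (br-⊕ʳ x _ _) (⊕-cong (br-⊙ʳ a x _) ≈-refl)))
              (∈S-⊕ (∈S-⊙ a (br-uS∈S s)) (br-lincomb∈S x cs br-uS∈S))

    br∈S : ∀ x {y} → (∀ s → InSpanS ⁅ x , uS s ⁆) → InSpanS y → InSpanS ⁅ x , y ⁆
    br∈S x br-uS∈S (cs , y≈cs) = ∈S-resp (br-cong ≈-refl (≈-sym y≈cs)) (br-lincomb∈S x cs br-uS∈S)

    br-uS∈S : ∀ x s → InSpanS ⁅ x , uS s ⁆
    br-uS∈S (gen k)   s = br-gen-uS∈S k s
    br-uS∈S 𝟘         s = ∈S-zero (br-zeroˡ _)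
    br-uS∈S (x ⊕ y)   s = ∈S-resp (≈-sym (br-⊕ˡ x y _)) (∈S-⊕ (br-uS∈S x s) (br-uS∈S y s))
    br-uS∈S (a ⊙ x)   s = ∈S-resp (≈-sym (br-⊙ˡ a x _)) (∈S-⊙ a (br-uS∈S x s))
    br-uS∈S ⁅ x , y ⁆ s = ∈S-resp jacobi′
      (∈S-⊕ (br∈S x (br-uS∈S x) (br-uS∈S y s)) (∈S-⊙ (-ᴷ 1ᴷ) (br∈S y (br-uS∈S y) (br-uS∈S x s))))
      where
      jacobi′ : ⁅ x , ⁅ y , uS s ⁆ ⁆ ⊕ - ⁅ y , ⁅ x , uS s ⁆ ⁆ ≈ ⁅ ⁅ x , y ⁆ , uS s ⁆
      jacobi′ = solve (⁅ x , ⁅ y , uS s ⁆ ⁆ ∷ ⁅ y , ⁅ x , uS s ⁆ ⁆ ∷ ⁅ ⁅ x , y ⁆ , uS s ⁆ ∷ [])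
        (v 0 ⊞ ⊟ v 1) (v 2) (hyp 1 (v 0) (v 2 ⊞ v 1) (br-leibniz x y (uS s)) ∷ [])

    ideal : IsIdeal InSpanS
    ideal = record
      { resp  = ∈S-resp
      ; zero∈ = ∈S-zero ≈-refl
      ; ⊕∈    = ∈S-⊕
      ; ⊙∈    = ∈S-⊙
      ; br∈   = λ x → br∈S x (br-uS∈S x)
      }

lemma2p9 : ∀ {c ℓ : Level} (K : Field c ℓ) → CharZero K →
    ∀ (n : ℕ) → 2 ≤ n → Electrical.IsIdeal K n (Electrical.InSpanS K n)
lemma2p9 K charZero n _ = ElectricalAlgebra.ideal K n charZero
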